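{- Let $d\geq 3$ and $k\geq 1$ be integers, and let $p_{d,k,n}$ be the number of directed plateau polyhypercubes of dimension $d$, width $k$ and lateral area $n$. Then for $n\geq (d-1)k$, $$p_{d,k,n}=\sum_{\substack{j_2+j_3+\cdots+j_d=n\\ j_2,\dots,j_d\geq 1}} \prod_{l=2}^{d}\binom{j_l+k-2}{j_l-k},$$ with the convention that $\binom{m}{r}=0$ for $m\geq 0$ and $r<0$ or $r>m$.
   Context: Work in $\mathbb{Z}^d$ with orthonormal coordinate system $(0,\vec{i_1},\dots,\vec{i_d})$. A cell is a unit hypercube with integer vertices. A polyhypercube of dimension $d$ is a finite union of cells, connected through their $(d-1)$-dimensional faces, defined up to translation. An elementary step is a positive move of one unit along one of the axes $\vec{i_j}$. A polyhypercube is directed if there is a root cell from which every cell can be reached by a path of cells made only of elementary steps. The width is the number of strata, a stratum being the set of cells with a given $\vec{i_1}$-coordinate. A plateau is a stratum that is a hyperrectangle (box) of cells; a directed plateau polyhypercube is a directed polyhypercube all of whose strata are plateaus. The lateral area of a polyhypercube is the sum, over $2\leq l\leq d$, of the areas (numbers of unit squares) of the polyominoes obtained by projecting it onto the planes $(\vec{i_1},\vec{i_l})$. -}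

module Defs where

open import Data.Nat as ℕ using (ℕ; zero; suc; _∸_; _≤_; _≤?_)
open import Data.Nat.Combinatorics using (_C_)
open import Data.Nat.ListAction using (sum; product)
open import Data.Integer as ℤ using (ℤ; 0ℤ; 1ℤ)
open import Data.Fin using (Fin; toℕ)
open import Data.Vec as V using (Vec; []; _∷_; lookup; updateAt)
open import Data.List as L using (List; []; _∷_; length; map; filter; deduplicate; allFin; concatMap; applyUpTo)
open import Data.List.Membership.Propositional using (_∈_)
open import Data.List.Relation.Unary.Any using (Any)
open import Data.List.Relation.Unary.AllPairs using (AllPairs)
open import Data.Product using (Σ; ∃; ∃-syntax; _×_; _,_)
open import Data.Product.Properties using (≡-dec)
open import Data.Sum using (_⊎_)
open import Function.Bundles using (_⇔_)
open import Relation.Binary.PropositionalEquality using (_≡_)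
open import Relation.Nullary using (¬_)

-- A cell of ℤ^d is identified with its lowest vertex (a vector of d integers).
Cell : ℕ → Set
Cell d = Vec ℤ d

-- A finite union of cells, given by a list of its cells (set semantics via _∈_).
Poly : ℕ → Set
Poly d = List (Cell d)

-- first coordinate (along i₁); only used for d ≥ 1
x₁ : ∀ {d} → Cell d → ℤ
x₁ []      = 0ℤ
x₁ (x ∷ _) = x

stepUp : ∀ {d} → Fin d → Cell d → Cell d
stepUp j c = updateAt c j (ℤ._+ 1ℤ)

stepDown : ∀ {d} → Fin d → Cell d → Cell d
stepDown j c = updateAt c j (ℤ._- 1ℤ)

Adjacent : ∀ {d} → Cell d → Cell d → Set
Adjacent a b = ∃[ j ] (b ≡ stepUp j a ⊎ b ≡ stepDown j a)

data Conn {d} (P : Poly d) : Cell d → Cell d → Set where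
  start : ∀ {a} → a ∈ P → Conn P a a
  next  : ∀ {a b c} → Conn P a b → Adjacent b c → c ∈ P → Conn P a c

Connected : ∀ {d} → Poly d → Set
Connected P = ∀ a b → a ∈ P → b ∈ P → Conn P a b

data Reach {d} (P : Poly d) : Cell d → Cell d → Set where
  start : ∀ {a} → a ∈ P → Reach P a a
  next  : ∀ {a b} → Reach P a b → (j : Fin d) → stepUp j b ∈ P → Reach P a (stepUp j b)

Directed : ∀ {d} → Poly d → Set
Directed P = ∃[ r ] (r ∈ P × (∀ c → c ∈ P → Reach P r c))

InBox : ∀ {d} → Cell d → Cell d → Cell d → Set
InBox lo hi c = ∀ l → (lookup lo l ℤ.≤ lookup c l) × (lookup c l ℤ.≤ lookup hi l)

-- every stratum (cells with a given i₁-coordinate) is a hyperrectangle of cells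
Plateau : ∀ {d} → Poly d → Set
Plateau P = ∀ c → c ∈ P →
  ∃[ lo ] ∃[ hi ] (∀ c′ → ((c′ ∈ P × x₁ c′ ≡ x₁ c) ⇔ InBox lo hi c′))

width : ∀ {d} → Poly d → ℕ
width P = length (deduplicate ℤ._≟_ (map x₁ P))

projArea : ∀ {d} → Poly d → Fin d → ℕ
projArea P l = length (deduplicate (≡-dec ℤ._≟_ ℤ._≟_) (map (λ c → (x₁ c , lookup c l)) P))

-- sum over l = 2..d (0-based indices 1..d-1)
lateralArea : ∀ {d} → Poly d → ℕ
lateralArea {d} P = sum (map (projArea P) (filter (λ l → 1 ≤? toℕ l) (allFin d)))

DPP : ∀ d → ℕ → ℕ → Poly d → Set
DPP d k n P = Connected P × Directed P × Plateau P × width P ≡ k × lateralArea P ≡ n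

_≈ₜ_ : ∀ {d} → Poly d → Poly d → Set
P ≈ₜ Q = ∃[ t ] (∀ c → (c ∈ P ⇔ V.zipWith ℤ._+_ c t ∈ Q))

-- N is the number of directed plateau polyhypercubes (up to translation) of
-- dimension d, width k, lateral area n: a list of representatives, one per class.
IsCountDPP : ℕ → ℕ → ℕ → ℕ → Set
IsCountDPP d k n N = Σ (List (Poly d)) λ Ls →
  length Ls ≡ N
  × (∀ P → P ∈ Ls → DPP d k n P)
  × (∀ P → DPP d k n P → Any (P ≈ₜ_) Ls)
  × AllPairs (λ P Q → ¬ (P ≈ₜ Q)) Ls

-- binomial with convention (m choose r) = 0 for r < 0 or r > m:
-- term(j) = binom(j+k-2, j-k), where j ≥ 1, k ≥ 1 so j+k-2 ≥ 0
term : ℕ → ℕ → ℕ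
term k j with k ≤? j
... | Relation.Nullary.yes _ = (j ℕ.+ k ∸ 2) C (j ∸ k)
... | Relation.Nullary.no _  = 0

compositions : ℕ → ℕ → List (List ℕ)
compositions zero zero    = [] ∷ []
compositions zero (suc _) = []
compositions (suc r) n =
  concatMap (λ j → map (j ∷_) (compositions r (n ∸ j))) (applyUpTo suc n)

formula : ℕ → ℕ → ℕ → ℕ
formula d k n = sum (map (λ js → product (map (term k) js)) (compositions (d ∸ 1) n))

module Submission where

-- A directed plateau polyhypercube of width k has strata 0, …, k − 1 above its root, each a box. Along
-- a lateral axis l the boxes project to intervals [aᵢ, bᵢ], and directedness forces aᵢ ≤ aᵢ₊₁ ≤ bᵢ,
-- since the lowest corner of stratum i + 1 can only be entered from stratum i. Up to translation
-- (a₀ = 0) these intervals are the word a₁ − a₀, b₀ − a₁, a₂ − a₁, …, b_{k−1} − a_{k−1} of 2k − 1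
-- natural numbers, whose sum plus k is the area of the projection onto the plane (i₁, i_l); conversely
-- every tuple of such words builds a directed plateau polyhypercube. So the polyhypercubes of lateral
-- area n correspond to a composition n = j₂ + ⋯ + j_d together with, for each l, one of the
-- C(j_l + k − 2, j_l − k) words of length 2k − 1 and sum j_l − k.

open import Defs

open import Data.Nat using (ℕ; zero; suc; _+_; _*_; _∸_; _≤_; _<_; z≤n; s≤s; _≤?_)
open import Data.Nat.Properties
open import Data.Nat.Tactic.RingSolver using (solve-∀)
open import Data.Integer.Tactic.RingSolver renaming (solve-∀ to solve-ℤ)
open import Data.Nat.Combinatorics using (_C_; nCk+nC[k+1]≡[n+1]C[k+1]; k>n⇒nCk≡0)
open import Data.Nat.ListAction using (sum; product)
open import Data.List as List using (List; []; _∷_; length; map; _++_; concatMap; applyUpTo; upTo; replicate; deduplicate)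
open import Data.List.Properties
  using ( ∷-injectiveʳ; length-++; length-map; length-replicate; length-applyUpTo; length-tabulate
        ; map-cong; map-cong-local; map-∘; map-upTo; map-tabulate; tabulate-cong )
open import Data.List.Membership.Propositional using (_∈_; find)
open import Data.List.Extrema.Nat using (argmax; argmax-all; f[xs]≤f[argmax])
open import Data.List.Membership.Propositional.Properties
open import Data.List.Membership.Propositional.Properties.WithK using (unique∧set⇒bag)
open import Data.List.Relation.Binary.BagAndSetEquality using (∼bag⇒↭)
open import Data.List.Relation.Binary.Permutation.Propositional.Properties using (↭-length)
open import Data.List.Relation.Binary.Subset.Propositional using (_⊆_)
open import Data.List.Relation.Unary.Any as Any using (Any; here; there)
open import Data.List.Relation.Unary.All as All using (All; []; _∷_)
import Data.List.Relation.Unary.All.Properties as All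
open import Data.List.Relation.Unary.AllPairs using (AllPairs; []; _∷_)
open import Data.List.Relation.Unary.Unique.Propositional using (Unique)
import Data.List.Relation.Unary.Unique.Propositional.Properties as Unique
import Data.List.Relation.Unary.Unique.DecPropositional.Properties as UniqueDec
open import Data.Integer as ℤ using (ℤ; 0ℤ; 1ℤ; ∣_∣; +≤+)
import Data.Integer.Properties as ℤₚ
open import Algebra.Properties.AbelianGroup ℤₚ.+-0-abelianGroup
  using () renaming (∙-cancelˡ to +-cancelˡ-ℤ; ∙-cancelʳ to +-cancelʳ-ℤ)
import Data.Vec.Properties as Vec
import Data.Vec.Relation.Unary.All as VecAll
open VecAll using ([]; _∷_)
import Data.Vec.Relation.Unary.All.Properties as VecAll
open import Data.Vec.Relation.Binary.Pointwise.Inductive as Pointwise using (Pointwise; []; _∷_)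
open import Data.Vec as Vec using (Vec; []; _∷_)
open import Data.Fin as Fin using (Fin; zero; suc; toℕ)
open import Data.Maybe using (fromMaybe)
open import Data.Product using (Σ; ∃-syntax; _×_; _,_; proj₁; proj₂)
open import Data.Product.Properties using (≡-dec)
open import Data.Sum using (_⊎_; inj₁; inj₂)
open import Data.Empty using (⊥; ⊥-elim)
open import Data.Unit using (⊤; tt)
open import Function.Base using (id; _∘_; _∘′_; case_of_)
open import Function.Bundles using (_⇔_; mk⇔; module Equivalence)
open import Relation.Nullary using (yes; no; ¬_)
open import Relation.Binary.Definitions using (DecidableEquality)
open import Relation.Binary.PropositionalEquality

module _ {A : Set} where

  unique∧set⇒length-≡ : {xs ys : List A} → Unique xs → Unique ys →
    xs ⊆ ys → ys ⊆ xs → length xs ≡ length ys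
  unique∧set⇒length-≡ xs! ys! xs⊆ys ys⊆xs =
    ↭-length (∼bag⇒↭ (unique∧set⇒bag xs! ys! (mk⇔ xs⊆ys ys⊆xs)))

  length-deduplicate-≡ : (_≟_ : DecidableEquality A) (xs : List A) {ys : List A} → Unique ys →
    xs ⊆ ys → ys ⊆ xs → length (deduplicate _≟_ xs) ≡ length ys
  length-deduplicate-≡ _≟_ xs ys! xs⊆ys ys⊆xs =
    unique∧set⇒length-≡ (UniqueDec.deduplicate-! _≟_ xs) ys!
      (xs⊆ys ∘′ ∈-deduplicate⁻ _≟_ xs) (∈-deduplicate⁺ _≟_ ∘′ ys⊆xs)

module _ {A B : Set} where

  ∈-concatMap⁻-∃ : (f : A → List B) (xs : List A) {y : B} →
    y ∈ concatMap f xs → ∃[ x ] (x ∈ xs × y ∈ f x)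
  ∈-concatMap⁻-∃ f xs y∈ = find (∈-concatMap⁻ f {xs = xs} y∈)

  ∈-concatMap⁺-∈ : (f : A → List B) {xs : List A} {x : A} {y : B} →
    x ∈ xs → y ∈ f x → y ∈ concatMap f xs
  ∈-concatMap⁺-∈ f {xs} x∈ y∈ = ∈-concatMap⁺ f {xs = xs} (Any.map (λ { refl → y∈ }) x∈)

  length-concatMap : (f : A → List B) (xs : List A) →
    length (concatMap f xs) ≡ sum (map (length ∘ f) xs)
  length-concatMap f [] = refl
  length-concatMap f (x ∷ xs) = trans (length-++ (f x)) (cong (length (f x) +_) (length-concatMap f xs))

  concatMap-unique : (f : A → List B) (tag : B → A) {xs : List A} → Unique xs →
    (∀ x → Unique (f x)) → (∀ x {y} → y ∈ f x → tag y ≡ x) → Unique (concatMap f xs)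
  concatMap-unique f tag [] f! tag-f = []
  concatMap-unique f tag {x ∷ xs} (x∉xs ∷ xs!) f! tag-f =
    Unique.++⁺ (f! x) (concatMap-unique f tag xs! f! tag-f) disjoint
    where
    disjoint : ∀ {y} → ¬ (y ∈ f x × y ∈ concatMap f xs)
    disjoint (y∈fx , y∈rest) with ∈-concatMap⁻-∃ f xs y∈rest
    ... | x′ , x′∈xs , y∈fx′ = All.lookup x∉xs x′∈xs (trans (sym (tag-f x y∈fx)) (tag-f x′ y∈fx′))

applyUpTo-cong : ∀ {A : Set} {f g : ℕ → A} → (∀ i → f i ≡ g i) → ∀ n → applyUpTo f n ≡ applyUpTo g n
applyUpTo-cong f≗g zero = refl
applyUpTo-cong f≗g (suc n) = cong₂ _∷_ (f≗g 0) (applyUpTo-cong (f≗g ∘ suc) n)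

module _ {A B : Set} (_≟ᴬ_ : DecidableEquality A) (_≟ᴮ_ : DecidableEquality B) where

  length-deduplicate-image : (f : A → B) → (∀ {x y} → f x ≡ f y → x ≡ y) → ∀ xs ys →
    map f xs ⊆ ys → (∀ {y} → y ∈ ys → ∃[ x ] (x ∈ xs × y ≡ f x)) →
    length (deduplicate _≟ᴬ_ xs) ≡ length (deduplicate _≟ᴮ_ ys)
  length-deduplicate-image f f-injective xs ys image⊆ ⊆image = begin
    length (deduplicate _≟ᴬ_ xs)         ≡⟨ length-map f (deduplicate _≟ᴬ_ xs) ⟨
    length (map f (deduplicate _≟ᴬ_ xs)) ≡⟨ length-deduplicate-≡ _≟ᴮ_ ys image-unique ys⊆ ⊆ys ⟨
    length (deduplicate _≟ᴮ_ ys)         ∎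
    where
    open ≡-Reasoning
    image-unique = Unique.map⁺ f-injective (UniqueDec.deduplicate-! _≟ᴬ_ xs)
    ⊆ys : map f (deduplicate _≟ᴬ_ xs) ⊆ ys
    ⊆ys y∈ with x , x∈ , refl ← ∈-map⁻ f y∈ = image⊆ (∈-map⁺ f (∈-deduplicate⁻ _≟ᴬ_ xs x∈))
    ys⊆ : ys ⊆ map f (deduplicate _≟ᴬ_ xs)
    ys⊆ y∈ with x , x∈ , refl ← ⊆image y∈ = ∈-map⁺ f (∈-deduplicate⁺ _≟ᴬ_ x∈)

unique-map-≉ : ∀ {A B : Set} {_≈_ : B → B → Set} (f : A → B) {xs : List A} →
  (∀ {x y} → x ∈ xs → y ∈ xs → f x ≈ f y → x ≡ y) → Unique xs → AllPairs (λ a b → ¬ a ≈ b) (map f xs)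
unique-map-≉ f f-injective [] = []
unique-map-≉ f f-injective (x∉xs ∷ xs!) =
  All.map⁺ (All.tabulate (λ y∈ fx≈fy → All.lookup x∉xs y∈ (f-injective (here refl) (there y∈) fx≈fy))) ∷
  unique-map-≉ f (λ x∈ y∈ → f-injective (there x∈) (there y∈)) xs!

module _ {A : Set} where

  -- Empty unless there are exactly e lists.
  choices : (e : ℕ) → List (List A) → List (Vec A e)
  choices zero [] = [] ∷ []
  choices (suc e) (xs ∷ xss) = concatMap (λ x → map (x ∷_) (choices e xss)) xs
  choices zero (_ ∷ _) = []
  choices (suc e) [] = []

  ChosenFrom : ∀ {e} → Vec A e → List (List A) → Set
  ChosenFrom [] [] = ⊤
  ChosenFrom (x ∷ v) (xs ∷ xss) = x ∈ xs × ChosenFrom v xss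
  ChosenFrom [] (_ ∷ _) = ⊥
  ChosenFrom (_ ∷ _) [] = ⊥

  ∈-choices⁻ : ∀ e xss {v} → v ∈ choices e xss → ChosenFrom v xss
  ∈-choices⁻ zero [] (here refl) = tt
  ∈-choices⁻ (suc e) (xs ∷ xss) v∈ with ∈-concatMap⁻-∃ (λ x → map (x ∷_) (choices e xss)) xs v∈
  ... | x , x∈ , p with ∈-map⁻ (x ∷_) p
  ... | v , v∈ , refl = x∈ , ∈-choices⁻ e xss v∈

  ∈-choices⁺ : ∀ e xss {v} → ChosenFrom v xss → v ∈ choices e xss
  ∈-choices⁺ zero [] {[]} tt = here refl
  ∈-choices⁺ (suc e) (xs ∷ xss) {x ∷ v} (x∈ , v∈) =
    ∈-concatMap⁺-∈ (λ x → map (x ∷_) (choices e xss)) x∈ (∈-map⁺ (x ∷_) (∈-choices⁺ e xss v∈))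

  length-choices : ∀ e xss → length xss ≡ e → length (choices e xss) ≡ product (map length xss)
  length-choices zero [] refl = refl
  length-choices (suc e) (xs ∷ xss) refl = begin
    length (concatMap (λ x → map (x ∷_) (choices e xss)) xs)
      ≡⟨ length-concatMap (λ x → map (x ∷_) (choices e xss)) xs ⟩
    sum (map (λ x → length (map (x ∷_) (choices e xss))) xs)
      ≡⟨ cong sum (map-cong (λ x → length-map (x ∷_) (choices e xss)) xs) ⟩
    sum (map (λ _ → length (choices e xss)) xs)
      ≡⟨ sum-map-const (length (choices e xss)) xs ⟩
    length xs * length (choices e xss)
      ≡⟨ cong (length xs *_) (length-choices e xss refl) ⟩
    length xs * product (map length xss) ∎
    where
    open ≡-Reasoning
    sum-map-const : ∀ c (ys : List A) → sum (map (λ _ → c) ys) ≡ length ys * c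
    sum-map-const c [] = refl
    sum-map-const c (_ ∷ ys) = cong (c +_) (sum-map-const c ys)

  choices-unique : ∀ e xss → All Unique xss → Unique (choices e xss)
  choices-unique zero [] _ = [] ∷ []
  choices-unique zero (_ ∷ _) _ = []
  choices-unique (suc e) [] _ = []
  choices-unique (suc e) (xs ∷ xss) (xs! ∷ xss!) =
    concatMap-unique (λ x → map (x ∷_) (choices e xss)) Vec.head xs!
      (λ x → Unique.map⁺ (λ { refl → refl }) (choices-unique e xss xss!))
      (λ x p → case ∈-map⁻ (x ∷_) p of λ { (_ , _ , refl) → refl })

-- Compositions

incrementHead : List ℕ → List ℕ
incrementHead [] = []
incrementHead (x ∷ xs) = suc x ∷ xs

incrementHead-injective : ∀ {xs ys} → incrementHead xs ≡ incrementHead ys → xs ≡ ys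
incrementHead-injective {[]} {[]} _ = refl
incrementHead-injective {_ ∷ _} {_ ∷ _} refl = refl

weakCompositions : ℕ → ℕ → List (List ℕ)
weakCompositions m zero = replicate m 0 ∷ []
weakCompositions zero (suc N) = []
weakCompositions (suc m) (suc N) =
  map incrementHead (weakCompositions (suc m) N) ++ map (0 ∷_) (weakCompositions m (suc N))

length-weakCompositions : ∀ m N → length (weakCompositions m N) ≡ (N + m ∸ 1) C N
length-weakCompositions m zero = refl
length-weakCompositions zero (suc N) = sym (k>n⇒nCk≡0 (s≤s (≤-reflexive (+-identityʳ N))))
length-weakCompositions (suc m) (suc N) = begin
  length (map incrementHead (weakCompositions (suc m) N) ++ map (0 ∷_) (weakCompositions m (suc N)))
    ≡⟨ length-++ (map incrementHead (weakCompositions (suc m) N)) ⟩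
  length (map incrementHead (weakCompositions (suc m) N)) + length (map (0 ∷_) (weakCompositions m (suc N)))
    ≡⟨ cong₂ _+_ (length-map incrementHead (weakCompositions (suc m) N)) (length-map (0 ∷_) (weakCompositions m (suc N))) ⟩
  length (weakCompositions (suc m) N) + length (weakCompositions m (suc N))
    ≡⟨ cong₂ _+_ (length-weakCompositions (suc m) N) (length-weakCompositions m (suc N)) ⟩
  (N + suc m ∸ 1) C N + (N + m) C suc N
    ≡⟨ cong (λ x → (x ∸ 1) C N + (N + m) C suc N) (+-suc N m) ⟩
  (N + m) C N + (N + m) C suc N
    ≡⟨ nCk+nC[k+1]≡[n+1]C[k+1] (N + m) N ⟩
  suc (N + m) C suc N
    ≡⟨ cong (λ x → (x ∸ 1) C suc N) (sym (+-suc (suc N) m)) ⟩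
  (suc N + suc m ∸ 1) C suc N ∎
  where open ≡-Reasoning

weakCompositions-unique : ∀ m N → Unique (weakCompositions m N)
weakCompositions-unique m zero = [] ∷ []
weakCompositions-unique zero (suc N) = []
weakCompositions-unique (suc m) (suc N) =
  Unique.++⁺ (Unique.map⁺ incrementHead-injective (weakCompositions-unique (suc m) N))
             (Unique.map⁺ ∷-injectiveʳ (weakCompositions-unique m (suc N)))
             disjoint
  where
  disjoint : ∀ {w} → ¬ (w ∈ map incrementHead (weakCompositions (suc m) N) × w ∈ map (0 ∷_) (weakCompositions m (suc N)))
  disjoint (p , q) with ∈-map⁻ incrementHead p | ∈-map⁻ (0 ∷_) q
  ... | x ∷ _ , _ , refl | _ , _ , ()

∈-weakCompositions⁻ : ∀ m N {w} → w ∈ weakCompositions m N → length w ≡ m × sum w ≡ N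
∈-weakCompositions⁻ m zero (here refl) = length-replicate m , sum-replicate-0 m
  where
  sum-replicate-0 : ∀ m → sum (replicate m 0) ≡ 0
  sum-replicate-0 zero = refl
  sum-replicate-0 (suc m) = sum-replicate-0 m
∈-weakCompositions⁻ (suc m) (suc N) w∈ with ∈-++⁻ (map incrementHead (weakCompositions (suc m) N)) w∈
... | inj₁ p with ∈-map⁻ incrementHead p
...   | [] , v∈ , refl with () ← proj₁ (∈-weakCompositions⁻ (suc m) N v∈)
...   | x ∷ v , v∈ , refl with ∈-weakCompositions⁻ (suc m) N v∈
...     | len , s = len , cong suc s
∈-weakCompositions⁻ (suc m) (suc N) w∈ | inj₂ q with ∈-map⁻ (0 ∷_) q
... | v , v∈ , refl with ∈-weakCompositions⁻ m (suc N) v∈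
...   | len , s = cong suc len , s

∈-weakCompositions⁺ : ∀ m N {w} → length w ≡ m → sum w ≡ N → w ∈ weakCompositions m N
∈-weakCompositions⁺ m zero {w} refl s = here (all-zero w s)
  where
  all-zero : ∀ w → sum w ≡ 0 → w ≡ replicate (length w) 0
  all-zero [] _ = refl
  all-zero (zero ∷ w) s = cong (0 ∷_) (all-zero w s)
∈-weakCompositions⁺ (suc m) (suc N) {zero ∷ w} refl s =
  ∈-++⁺ʳ (map incrementHead (weakCompositions (suc m) N)) (∈-map⁺ (0 ∷_) (∈-weakCompositions⁺ m (suc N) refl s))
∈-weakCompositions⁺ (suc m) (suc N) {suc x ∷ w} refl s =
  ∈-++⁺ˡ (∈-map⁺ incrementHead (∈-weakCompositions⁺ (suc m) N refl (suc-injective s)))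

∈-compositions⁻ : ∀ r n {js} → js ∈ compositions r n → length js ≡ r × sum js ≡ n × All (1 ≤_) js
∈-compositions⁻ zero zero (here refl) = refl , refl , []
∈-compositions⁻ (suc r) n js∈ with ∈-concatMap⁻-∃ (λ j → map (j ∷_) (compositions r (n ∸ j))) (applyUpTo suc n) js∈
... | j , j∈ , q with ∈-map⁻ (j ∷_) q | ∈-applyUpTo⁻ suc j∈
... | js , js∈ , refl | i , i<n , refl with ∈-compositions⁻ r (n ∸ suc i) js∈
... | len , s , pos = cong suc len , trans (cong (suc i +_) s) (m+[n∸m]≡n i<n) , s≤s z≤n ∷ pos

∈-compositions⁺ : ∀ r n {js} → length js ≡ r → sum js ≡ n → All (1 ≤_) js → js ∈ compositions r n
∈-compositions⁺ zero zero {[]} refl refl [] = here refl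
∈-compositions⁺ (suc r) n {suc i ∷ js} refl refl (_ ∷ pos) =
  ∈-concatMap⁺-∈ (λ j → map (j ∷_) (compositions r (n ∸ j)))
    (∈-applyUpTo⁺ suc (s≤s (m≤m+n i (sum js))))
    (∈-map⁺ (suc i ∷_) (∈-compositions⁺ r (n ∸ suc i) refl (sym (m+n∸m≡n (suc i) (sum js))) pos))

compositions-unique : ∀ r n → Unique (compositions r n)
compositions-unique zero zero = [] ∷ []
compositions-unique zero (suc n) = []
compositions-unique (suc r) n =
  concatMap-unique (λ j → map (j ∷_) (compositions r (n ∸ j))) (fromMaybe 0 ∘ List.head)
    (Unique.applyUpTo⁺₁ suc n (λ i<j _ eq → <-irrefl (suc-injective eq) i<j))
    (λ j → Unique.map⁺ ∷-injectiveʳ (compositions-unique r (n ∸ j)))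
    (λ j p → case ∈-map⁻ (j ∷_) p of λ { (_ , _ , refl) → refl })

-- Words

-- The word o₁ p₁ … o_{k−1} p_{k−1} q stands for o_{i+1} = a_{i+1} − aᵢ, p_{i+1} = bᵢ − a_{i+1} and
-- q = b_{k−1} − a_{k−1} with a₀ = 0; lower and upper recover aᵢ and bᵢ.
data IsWord : ℕ → List ℕ → Set where
  last : ∀ q → IsWord 1 (q ∷ [])
  more : ∀ {k r} o p → IsWord (suc k) r → IsWord (suc (suc k)) (o ∷ p ∷ r)

lower : List ℕ → ℕ → ℕ
lower w zero = 0
lower (o ∷ p ∷ r) (suc i) = o + lower r i
lower _ (suc _) = 0

upper : List ℕ → ℕ → ℕ
upper (q ∷ []) zero = q
upper (o ∷ p ∷ r) zero = o + p
upper (o ∷ p ∷ r) (suc i) = o + upper r i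
upper _ _ = 0

intervalSize : List ℕ → ℕ → ℕ
intervalSize w i = suc (upper w i) ∸ lower w i

lower≤upper : ∀ {k w i} → IsWord k w → i < k → lower w i ≤ upper w i
lower≤upper {i = zero} _ _ = z≤n
lower≤upper {i = suc i} (more o p r) (s≤s i<k) = +-monoʳ-≤ o (lower≤upper r i<k)

lower≤lower-suc : ∀ {k w i} → IsWord k w → suc i < k → lower w i ≤ lower w (suc i)
lower≤lower-suc {i = zero} _ _ = z≤n
lower≤lower-suc {i = suc i} (more o p r) (s≤s i<k) = +-monoʳ-≤ o (lower≤lower-suc r i<k)

lower-suc≤upper : ∀ {k w i} → IsWord k w → suc i < k → lower w (suc i) ≤ upper w i
lower-suc≤upper (last q) (s≤s ())
lower-suc≤upper {i = zero} (more o p r) _ = ≤-trans (≤-reflexive (+-identityʳ o)) (m≤m+n o p)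
lower-suc≤upper {i = suc i} (more o p r) (s≤s i<k) = +-monoʳ-≤ o (lower-suc≤upper r i<k)

sum-intervalSize : ∀ {k w} → IsWord k w → sum (applyUpTo (intervalSize w) k) ≡ sum w + k
sum-intervalSize (last q) = +-comm 1 (q + 0)
sum-intervalSize {suc (suc k)} {o ∷ p ∷ r} (more o p r-word) = begin
  suc (o + p) + sum (applyUpTo (intervalSize (o ∷ p ∷ r) ∘ suc) (suc k))
    ≡⟨ cong (λ xs → suc (o + p) + sum xs) (applyUpTo-cong shift (suc k)) ⟩
  suc (o + p) + sum (applyUpTo (intervalSize r) (suc k))
    ≡⟨ cong (suc (o + p) +_) (sum-intervalSize r-word) ⟩
  suc (o + p) + (sum r + suc k)
    ≡⟨ +-reassociate o p (sum r) k ⟩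
  o + (p + sum r) + suc (suc k) ∎
  where
  open ≡-Reasoning
  shift : ∀ i → intervalSize (o ∷ p ∷ r) (suc i) ≡ intervalSize r i
  shift i = trans (cong (_∸ (o + lower r i)) (sym (+-suc o (upper r i))))
                  ([m+n]∸[m+o]≡n∸o o (suc (upper r i)) (lower r i))
  +-reassociate : ∀ o p s k → suc (o + p) + (s + suc k) ≡ o + (p + s) + suc (suc k)
  +-reassociate = solve-∀

length-IsWord : ∀ {k w} → IsWord k w → length w ≡ k + k ∸ 1
length-IsWord (last q) = refl
length-IsWord {suc (suc k)} (more o p r) = cong suc (trans (cong suc (length-IsWord r)) (sym (+-suc k (suc k))))

IsWord-length : ∀ k w → 1 ≤ k → length w ≡ k + k ∸ 1 → IsWord k w
IsWord-length (suc zero) (q ∷ []) _ refl = last q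
IsWord-length (suc (suc k)) (o ∷ p ∷ r) _ len =
  more o p (IsWord-length (suc k) r (s≤s z≤n) (suc-injective (suc-injective (trans len (cong suc (+-suc k (suc k)))))))
IsWord-length (suc (suc k)) (_ ∷ []) _ len with () ← suc-injective (trans len (cong suc (+-suc k (suc k))))
IsWord-length (suc (suc k)) [] _ ()

words : ℕ → ℕ → List (List ℕ)
words k j with k ≤? j
... | yes _ = weakCompositions (k + k ∸ 1) (j ∸ k)
... | no _ = []

length-words : ∀ k j → 1 ≤ k → length (words k j) ≡ term k j
length-words k@(suc a) j _ with k ≤? j
... | no _ = refl
... | yes k≤j with t , refl ← m≤n⇒∃[o]m+o≡n k≤j =
  trans (length-weakCompositions (k + k ∸ 1) (k + t ∸ k))
        (cong (_C (k + t ∸ k)) (begin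
          k + t ∸ k + (k + k ∸ 1) ∸ 1 ≡⟨ cong (λ x → x + (k + k ∸ 1) ∸ 1) (m+n∸m≡n k t) ⟩
          t + (k + k ∸ 1) ∸ 1         ≡⟨ cong (_∸ 1) (word-length a t) ⟩
          k + t + k ∸ 2               ∎))
  where
  open ≡-Reasoning
  word-length : ∀ a t → t + (a + suc a) ≡ a + t + suc a
  word-length = solve-∀

∈-words⁻ : ∀ k j {w} → 1 ≤ k → w ∈ words k j → IsWord k w × sum w + k ≡ j
∈-words⁻ k j {w} 1≤k w∈ with k ≤? j
... | yes k≤j with len , s ← ∈-weakCompositions⁻ (k + k ∸ 1) (j ∸ k) w∈ =
  IsWord-length k w 1≤k len , trans (cong (_+ k) s) (m∸n+n≡m k≤j)

∈-words⁺ : ∀ k j {w} → IsWord k w → sum w + k ≡ j → w ∈ words k j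
∈-words⁺ k j {w} w-word s with k ≤? j
... | yes _ = ∈-weakCompositions⁺ (k + k ∸ 1) (j ∸ k) (length-IsWord w-word)
                (trans (sym (m+n∸n≡m (sum w) k)) (cong (_∸ k) s))
... | no k≰j = ⊥-elim (k≰j (subst (k ≤_) s (m≤n+m k (sum w))))

words-unique : ∀ k j → Unique (words k j)
words-unique k j with k ≤? j
... | yes _ = weakCompositions-unique (k + k ∸ 1) (j ∸ k)
... | no _ = []

IsStaircase : ℕ → (ℕ → ℕ) → (ℕ → ℕ) → Set
IsStaircase k a b = (∀ i → i < k → a i ≤ b i) × (∀ i → suc i < k → a i ≤ a (suc i) × a (suc i) ≤ b i)

wordOfIntervals : ℕ → (ℕ → ℕ) → (ℕ → ℕ) → List ℕ
wordOfIntervals zero a b = []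
wordOfIntervals (suc zero) a b = b 0 ∸ a 0 ∷ []
wordOfIntervals (suc (suc k)) a b = a 1 ∸ a 0 ∷ b 0 ∸ a 1 ∷ wordOfIntervals (suc k) (a ∘ suc) (b ∘ suc)

IsWord-wordOfIntervals : ∀ k a b → IsWord (suc k) (wordOfIntervals (suc k) a b)
IsWord-wordOfIntervals zero a b = last (b 0 ∸ a 0)
IsWord-wordOfIntervals (suc k) a b = more (a 1 ∸ a 0) (b 0 ∸ a 1) (IsWord-wordOfIntervals k (a ∘ suc) (b ∘ suc))

lower-upper-wordOfIntervals : ∀ k a b → IsStaircase k a b → ∀ i → i < k →
  a 0 + lower (wordOfIntervals k a b) i ≡ a i × a 0 + upper (wordOfIntervals k a b) i ≡ b i
lower-upper-wordOfIntervals (suc zero) a b (a≤b , _) zero _ = +-identityʳ (a 0) , m+[n∸m]≡n (a≤b 0 (s≤s z≤n))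
lower-upper-wordOfIntervals (suc zero) a b _ (suc i) (s≤s ())
lower-upper-wordOfIntervals (suc (suc k)) a b (a≤b , nested) i i<k = go i i<k
  where
  a₀≤a₁≤b₀ = nested 0 (s≤s (s≤s z≤n))
  a₀+[a₁∸a₀] : a 0 + (a 1 ∸ a 0) ≡ a 1
  a₀+[a₁∸a₀] = m+[n∸m]≡n (proj₁ a₀≤a₁≤b₀)
  r = wordOfIntervals (suc k) (a ∘ suc) (b ∘ suc)
  rest = lower-upper-wordOfIntervals (suc k) (a ∘ suc) (b ∘ suc)
           ((λ i i<k → a≤b (suc i) (s≤s i<k)) , (λ i i<k → nested (suc i) (s≤s i<k)))
  shift : ∀ x → a 0 + ((a 1 ∸ a 0) + x) ≡ a 1 + x
  shift x = trans (sym (+-assoc (a 0) (a 1 ∸ a 0) x)) (cong (_+ x) a₀+[a₁∸a₀])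
  go : ∀ i → i < suc (suc k) → a 0 + lower (wordOfIntervals (suc (suc k)) a b) i ≡ a i
                                × a 0 + upper (wordOfIntervals (suc (suc k)) a b) i ≡ b i
  go zero _ = +-identityʳ (a 0) , trans (shift (b 0 ∸ a 1)) (m+[n∸m]≡n (proj₂ a₀≤a₁≤b₀))
  go (suc i) (s≤s i<k) = trans (shift (lower r i)) (proj₁ (rest i i<k)) , trans (shift (upper r i)) (proj₂ (rest i i<k))

IsWord-ext : ∀ {k w w′} → IsWord k w → IsWord k w′ →
  (∀ i → i < k → lower w i ≡ lower w′ i × upper w i ≡ upper w′ i) → w ≡ w′
IsWord-ext (last q) (last q′) same = cong (_∷ []) (proj₂ (same 0 (s≤s z≤n)))
IsWord-ext (more o p r) (more o′ p′ r′) same with refl ← +-cancelʳ-≡ 0 o o′ (proj₁ (same 1 (s≤s (s≤s z≤n)))) =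
  cong (o ∷_) (cong₂ _∷_ (+-cancelˡ-≡ o p p′ (proj₂ (same 0 (s≤s z≤n))))
    (IsWord-ext r r′ λ i i<k → let lo , up = same (suc i) (s≤s i<k) in +-cancelˡ-≡ o _ _ lo , +-cancelˡ-≡ o _ _ up))

≤+1⇒≤∨≡+1 : ∀ {x z} → z ℤ.≤ x ℤ.+ 1ℤ → z ℤ.≤ x ⊎ z ≡ x ℤ.+ 1ℤ
≤+1⇒≤∨≡+1 {x} {z} z≤x+1 with z ℤ.≟ x ℤ.+ 1ℤ
... | yes z≡x+1 = inj₂ z≡x+1
... | no z≢x+1 = inj₁ (subst (z ℤ.≤_) (pred[x+1]≡x x) (ℤₚ.i<j⇒i≤pred[j] (ℤₚ.≤∧≢⇒< z≤x+1 z≢x+1)))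
  where pred[x+1]≡x : ∀ x → ℤ.-1ℤ ℤ.+ (x ℤ.+ 1ℤ) ≡ x
        pred[x+1]≡x = solve-ℤ

x+[1+n]≡x+n+1 : ∀ x n → x ℤ.+ ℤ.+ suc n ≡ x ℤ.+ ℤ.+ n ℤ.+ 1ℤ
x+[1+n]≡x+n+1 x n =
  trans (cong (ℤ._+_ x) (trans (ℤₚ.pos-+ 1 n) (ℤₚ.+-comm 1ℤ (ℤ.+ n)))) (sym (ℤₚ.+-assoc x (ℤ.+ n) 1ℤ))

x+1≰x : ∀ x → ¬ (x ℤ.+ 1ℤ ℤ.≤ x)
x+1≰x x = ℤₚ.<⇒≱ (ℤₚ.suc[i]≤j⇒i<j (ℤₚ.≤-reflexive (ℤₚ.+-comm 1ℤ x)))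

x+n≤x⇒n≡0 : ∀ {x n} → x ℤ.+ ℤ.+ n ℤ.≤ x → n ≡ 0
x+n≤x⇒n≡0 {x} {n} x+n≤x
  with ℤₚ.drop‿+≤+ (subst₂ ℤ._≤_ (-x+[x+n]≡n x (ℤ.+ n)) (ℤₚ.+-inverseˡ x) (ℤₚ.+-monoʳ-≤ (ℤ.- x) x+n≤x))
  where -x+[x+n]≡n : ∀ x y → ℤ.- x ℤ.+ (x ℤ.+ y) ≡ y
        -x+[x+n]≡n = solve-ℤ
... | z≤n = refl

module _ {a x : ℤ} (a≤x : a ℤ.≤ x) where

  +∣-∣ : ℤ.+ ∣ x ℤ.- a ∣ ≡ x ℤ.- a
  +∣-∣ = ℤₚ.0≤i⇒+∣i∣≡i (ℤₚ.i≤j⇒0≤j-i a≤x)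

  a+∣x-a∣ : a ℤ.+ ℤ.+ ∣ x ℤ.- a ∣ ≡ x
  a+∣x-a∣ = trans (cong (ℤ._+_ a) +∣-∣) (a+[x-a]≡x a x)
    where a+[x-a]≡x : ∀ a x → a ℤ.+ (x ℤ.- a) ≡ x
          a+[x-a]≡x = solve-ℤ

∣-∣-mono-≤ : ∀ {a x y} → a ℤ.≤ x → a ℤ.≤ y → x ℤ.≤ y ⇔ ∣ x ℤ.- a ∣ ≤ ∣ y ℤ.- a ∣
∣-∣-mono-≤ {a} {x} {y} a≤x a≤y = mk⇔
  (λ x≤y → ℤₚ.drop‿+≤+ (subst₂ ℤ._≤_ (sym (+∣-∣ a≤x)) (sym (+∣-∣ a≤y)) (ℤₚ.+-monoˡ-≤ (ℤ.- a) x≤y)))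
  (λ ≤ → subst₂ ℤ._≤_ (a+∣x-a∣ a≤x) (a+∣x-a∣ a≤y) (ℤₚ.+-monoʳ-≤ a (+≤+ ≤)))

stepDown∘stepUp : ∀ {d} (j : Fin d) (c : Cell d) → stepDown j (stepUp j c) ≡ c
stepDown∘stepUp j c = trans (Vec.updateAt-updateAt-local j c (x+1-1≡x (Vec.lookup c j))) (Vec.updateAt-id j c)
  where x+1-1≡x : ∀ x → x ℤ.+ 1ℤ ℤ.- 1ℤ ≡ x
        x+1-1≡x = solve-ℤ

stepUp∘stepDown : ∀ {d} (j : Fin d) (c : Cell d) → stepUp j (stepDown j c) ≡ c
stepUp∘stepDown j c = trans (Vec.updateAt-updateAt-local j c (x-1+1≡x (Vec.lookup c j))) (Vec.updateAt-id j c)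
  where x-1+1≡x : ∀ x → x ℤ.- 1ℤ ℤ.+ 1ℤ ≡ x
        x-1+1≡x = solve-ℤ

Adjacent-sym : ∀ {d} {a b : Cell d} → Adjacent a b → Adjacent b a
Adjacent-sym {a = a} (j , inj₁ refl) = j , inj₂ (sym (stepDown∘stepUp j a))
Adjacent-sym {a = a} (j , inj₂ refl) = j , inj₁ (sym (stepUp∘stepDown j a))

module _ {d} {P : Poly d} where

  Conn-trans : ∀ {a b c} → Conn P a b → Conn P b c → Conn P a c
  Conn-trans p (start _) = p
  Conn-trans p (next q adj c∈) = next (Conn-trans p q) adj c∈

  Conn-end : ∀ {a b} → Conn P a b → b ∈ P
  Conn-end (start b∈) = b∈
  Conn-end (next _ _ b∈) = b∈

  Conn-sym : ∀ {a b} → Conn P a b → Conn P b a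
  Conn-sym (start a∈) = start a∈
  Conn-sym (next p adj c∈) = Conn-trans (next (start c∈) (Adjacent-sym adj) (Conn-end p)) (Conn-sym p)

  Reach-trans : ∀ {a b c} → Reach P a b → Reach P b c → Reach P a c
  Reach-trans p (start _) = p
  Reach-trans p (next q j c∈) = next (Reach-trans p q) j c∈

  Reach-end : ∀ {a b} → Reach P a b → b ∈ P
  Reach-end (start b∈) = b∈
  Reach-end (next _ _ b∈) = b∈

  Reach⇒Conn : ∀ {a b} → Reach P a b → Conn P a b
  Reach⇒Conn (start a∈) = start a∈
  Reach⇒Conn (next p j c∈) = next (Reach⇒Conn p) (j , inj₁ refl) c∈

  Directed⇒Connected : Directed P → Connected P
  Directed⇒Connected (r , _ , reach) a b a∈ b∈ = Conn-trans (Conn-sym (Reach⇒Conn (reach a a∈))) (Reach⇒Conn (reach b b∈))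

  Reach-last-step : ∀ {a c} → Reach P a c → c ≡ a ⊎ ∃[ b ] ∃[ j ] (b ∈ P × c ≡ stepUp j b)
  Reach-last-step (start _) = inj₁ refl
  Reach-last-step (next p j _) = inj₂ (_ , j , Reach-end p , refl)

cell : ∀ {n} → Vec ℕ n → Cell n
cell = Vec.map (λ x → ℤ.+ x)

cell-injective : ∀ {n} {u v : Vec ℕ n} → cell u ≡ cell v → u ≡ v
cell-injective {u = []} {[]} _ = refl
cell-injective {u = _ ∷ _} {_ ∷ _} eq with refl , eqᵗ ← Vec.∷-injective eq = cong (_ ∷_) (cell-injective eqᵗ)

lookup-cell : ∀ {n} (v : Vec ℕ n) l → Vec.lookup (cell v) l ≡ ℤ.+ Vec.lookup v l
lookup-cell v l = Vec.lookup-map l (λ x → ℤ.+ x) v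

stepUp-cell : ∀ {n} (j : Fin n) (v : Vec ℕ n) → stepUp j (cell v) ≡ cell (Vec.updateAt v j suc)
stepUp-cell j v = sym (Vec.map-updateAt v j (cong (λ x → ℤ.+ x) (+-comm 1 _)))

infix 4 _≤ᶜ_
_≤ᶜ_ : ∀ {n} → Cell n → Cell n → Set
_≤ᶜ_ = Pointwise ℤ._≤_

InBox⇒≤ᶜ : ∀ {n} {lo hi c : Cell n} → InBox lo hi c → lo ≤ᶜ c × c ≤ᶜ hi
InBox⇒≤ᶜ {lo = []} {[]} {[]} _ = [] , []
InBox⇒≤ᶜ {lo = _ ∷ _} {_ ∷ _} {_ ∷ _} in-box =
  let lo≤c , c≤hi = InBox⇒≤ᶜ (in-box ∘ suc) in proj₁ (in-box zero) ∷ lo≤c , proj₂ (in-box zero) ∷ c≤hi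

≤ᶜ⇒InBox : ∀ {n} {lo hi c : Cell n} → lo ≤ᶜ c → c ≤ᶜ hi → InBox lo hi c
≤ᶜ⇒InBox lo≤c c≤hi l = Pointwise.lookup lo≤c l , Pointwise.lookup c≤hi l

stepUp-≤ᶜ : ∀ {n} (j : Fin n) (c : Cell n) → c ≤ᶜ stepUp j c
stepUp-≤ᶜ zero (x ∷ c) = ℤₚ.i≤i+j x (ℤ.+ 1) ∷ Pointwise.refl ℤₚ.≤-refl
stepUp-≤ᶜ (suc j) (x ∷ c) = ℤₚ.≤-refl ∷ stepUp-≤ᶜ j c

Reach-≤ᶜ : ∀ {n} {P : Poly n} {a b} → Reach P a b → a ≤ᶜ b
Reach-≤ᶜ (start _) = Pointwise.refl ℤₚ.≤-refl
Reach-≤ᶜ (next p j _) = Pointwise.trans ℤₚ.≤-trans (Reach-≤ᶜ p) (stepUp-≤ᶜ j _)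

infix 4 _≤ᵛ_
_≤ᵛ_ : ∀ {n} → Vec ℕ n → Vec ℕ n → Set
_≤ᵛ_ = Pointwise _≤_

≤ᵛ-refl : ∀ {n} {v : Vec ℕ n} → v ≤ᵛ v
≤ᵛ-refl = Pointwise.refl ≤-refl

≤ᵛ-trans : ∀ {n} {u v w : Vec ℕ n} → u ≤ᵛ v → v ≤ᵛ w → u ≤ᵛ w
≤ᵛ-trans = Pointwise.trans ≤-trans

Pointwise-antisym : ∀ {A : Set} {_≲_ : A → A → Set} → (∀ {x y} → x ≲ y → y ≲ x → x ≡ y) →
  ∀ {n} {u v : Vec A n} → Pointwise _≲_ u v → Pointwise _≲_ v u → u ≡ v
Pointwise-antisym antisym [] [] = refl
Pointwise-antisym antisym (x≲y ∷ u≲v) (y≲x ∷ v≲u) =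
  cong₂ _∷_ (antisym x≲y y≲x) (Pointwise-antisym antisym u≲v v≲u)

≤ᵛ-antisym : ∀ {n} {u v : Vec ℕ n} → u ≤ᵛ v → v ≤ᵛ u → u ≡ v
≤ᵛ-antisym = Pointwise-antisym ≤-antisym

≤ᵛ-update : ∀ {n} {a b : Vec ℕ n} → a ≤ᵛ b → ∀ l {y} → Vec.lookup a l ≤ y → y ≤ Vec.lookup b l →
  a ≤ᵛ a Vec.[ l ]≔ y × a Vec.[ l ]≔ y ≤ᵛ b
≤ᵛ-update (_ ∷ as≤bs) zero a≤y y≤b = a≤y ∷ ≤ᵛ-refl , y≤b ∷ as≤bs
≤ᵛ-update (a≤b ∷ as≤bs) (suc l) a≤y y≤b =
  let as≤vs , vs≤bs = ≤ᵛ-update as≤bs l a≤y y≤b in ≤-refl ∷ as≤vs , a≤b ∷ vs≤bs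

distance : ∀ {n} → Vec ℕ n → Vec ℕ n → ℕ
distance [] [] = 0
distance (a ∷ as) (b ∷ bs) = (b ∸ a) + distance as bs

distance≡0⇒≡ : ∀ {n} {a b : Vec ℕ n} → a ≤ᵛ b → distance a b ≡ 0 → a ≡ b
distance≡0⇒≡ [] _ = refl
distance≡0⇒≡ {a = a ∷ _} {b ∷ _} (a≤b ∷ as≤bs) d≡0 =
  cong₂ _∷_ (≤-antisym a≤b (m∸n≡0⇒m≤n (m+n≡0⇒m≡0 (b ∸ a) d≡0)))
            (distance≡0⇒≡ as≤bs (m+n≡0⇒n≡0 (b ∸ a) d≡0))

distance≡suc⇒step : ∀ {n} {a b : Vec ℕ n} → a ≤ᵛ b → ∀ {m} → distance a b ≡ suc m →
  ∃[ l ] ∃[ b′ ] (b ≡ Vec.updateAt b′ l suc × a ≤ᵛ b′ × b′ ≤ᵛ b × distance a b′ ≡ m)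
distance≡suc⇒step {a = a ∷ as} {b ∷ bs} (a≤b ∷ as≤bs) d≡1+m with m≤n⇒m<n∨m≡n a≤b
... | inj₁ (s≤s {n = b₀} a≤b₀) =
  zero , b₀ ∷ bs , refl , a≤b₀ ∷ as≤bs , n≤1+n b₀ ∷ ≤ᵛ-refl ,
  suc-injective (trans (cong (_+ distance as bs) (sym (+-∸-assoc 1 a≤b₀))) d≡1+m)
... | inj₂ refl
  with l , b′ , refl , as≤b′ , b′≤bs , d′ ← distance≡suc⇒step as≤bs (trans (cong (_+ distance as bs) (sym (n∸n≡0 a))) d≡1+m) =
  suc l , a ∷ b′ , refl , ≤-refl ∷ as≤b′ , ≤-refl ∷ b′≤bs , trans (cong (_+ distance as b′) (n∸n≡0 a)) d′

module _ {n} (P : Poly n) where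

  BoxIn : Vec ℕ n → Vec ℕ n → Set
  BoxIn a b = ∀ v → a ≤ᵛ v → v ≤ᵛ b → cell v ∈ P

  Reach-box : ∀ {a b} → a ≤ᵛ b → BoxIn a b → Reach P (cell a) (cell b)
  Reach-box {a} {b} a≤b box = go (distance a b) refl a≤b box
    where
    go : ∀ m {b} → distance a b ≡ m → a ≤ᵛ b → BoxIn a b → Reach P (cell a) (cell b)
    go zero d≡0 a≤b box with refl ← distance≡0⇒≡ a≤b d≡0 = start (box a ≤ᵛ-refl ≤ᵛ-refl)
    go (suc m) {b} d≡1+m a≤b box with l , b′ , refl , a≤b′ , b′≤b , d′ ← distance≡suc⇒step a≤b d≡1+m =
      subst (Reach P (cell a)) (stepUp-cell l b′)
        (next (go m d′ a≤b′ (λ v a≤v v≤b′ → box v a≤v (≤ᵛ-trans v≤b′ b′≤b))) l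
              (subst (_∈ P) (sym (stepUp-cell l b′)) (box _ a≤b ≤ᵛ-refl)))

-- Only meaningful when r ≤ᶜ c: ∣_∣ forgets signs.
displacement : ∀ {n} → Cell n → Cell n → Vec ℕ n
displacement [] [] = []
displacement (a ∷ r) (x ∷ c) = ∣ x ℤ.- a ∣ ∷ displacement r c

translate-displacement : ∀ {n} {r c : Cell n} → r ≤ᶜ c → Vec.zipWith ℤ._+_ c (Vec.map ℤ.-_ r) ≡ cell (displacement r c)
translate-displacement [] = refl
translate-displacement (a≤x ∷ r≤c) = cong₂ _∷_ (sym (+∣-∣ a≤x)) (translate-displacement r≤c)

translate≡cell⇒displacement : ∀ {n} {r c : Cell n} {v} → Vec.zipWith ℤ._+_ c (Vec.map ℤ.-_ r) ≡ cell v →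
  r ≤ᶜ c × displacement r c ≡ v
translate≡cell⇒displacement {r = []} {[]} {[]} _ = [] , refl
translate≡cell⇒displacement {r = _ ∷ _} {_ ∷ _} {_ ∷ _} eq with x-a≡m , eqᵗ ← Vec.∷-injective eq =
  let r≤c , disp≡v = translate≡cell⇒displacement eqᵗ
  in ℤₚ.0≤i-j⇒j≤i (subst (0ℤ ℤ.≤_) (sym x-a≡m) (+≤+ z≤n)) ∷ r≤c , cong₂ _∷_ (cong ∣_∣ x-a≡m) disp≡v

displacement-mono : ∀ {n} {r a b : Cell n} → r ≤ᶜ a → r ≤ᶜ b → a ≤ᶜ b ⇔ displacement r a ≤ᵛ displacement r b
displacement-mono [] [] = mk⇔ (λ _ → []) (λ _ → [])
displacement-mono (r≤x ∷ r≤a) (r≤y ∷ r≤b) = mk⇔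
  (λ { (x≤y ∷ a≤b) → Equivalence.to (∣-∣-mono-≤ r≤x r≤y) x≤y ∷ Equivalence.to (displacement-mono r≤a r≤b) a≤b })
  (λ { (x≤y ∷ a≤b) → Equivalence.from (∣-∣-mono-≤ r≤x r≤y) x≤y ∷
                     Equivalence.from (displacement-mono r≤a r≤b) a≤b })

displacement-lookup-mono : ∀ {n} {r a b : Cell n} → r ≤ᶜ a → r ≤ᶜ b → ∀ l →
  Vec.lookup a l ℤ.≤ Vec.lookup b l → Vec.lookup (displacement r a) l ≤ Vec.lookup (displacement r b) l
displacement-lookup-mono (r≤x ∷ _) (r≤y ∷ _) zero = Equivalence.to (∣-∣-mono-≤ r≤x r≤y)
displacement-lookup-mono (_ ∷ r≤a) (_ ∷ r≤b) (suc l) = displacement-lookup-mono r≤a r≤b l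

displacement-self : ∀ {n} (c : Cell n) → displacement c c ≡ Vec.replicate n 0
displacement-self [] = refl
displacement-self (x ∷ c) = cong₂ _∷_ (cong ∣_∣ (ℤₚ.+-inverseʳ x)) (displacement-self c)

head∷tabulate : ∀ {A : Set} {n} (v : Vec A (suc n)) → v ≡ Vec.head v ∷ Vec.tabulate (λ l → Vec.lookup v (suc l))
head∷tabulate (x ∷ v) = cong (x ∷_) (sym (Vec.tabulate∘lookup v))

x₁-displacement : ∀ {e} {r c : Cell (suc e)} → r ≤ᶜ c → x₁ c ≡ x₁ r ℤ.+ ℤ.+ Vec.head (displacement r c)
x₁-displacement (a≤x ∷ _) = sym (a+∣x-a∣ a≤x)

InBox-cell⁺ : ∀ {n} {a b v : Vec ℕ n} → a ≤ᵛ v → v ≤ᵛ b → InBox (cell a) (cell b) (cell v)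
InBox-cell⁺ (a≤v ∷ _) (v≤b ∷ _) zero = +≤+ a≤v , +≤+ v≤b
InBox-cell⁺ (_ ∷ as≤vs) (_ ∷ vs≤bs) (suc l) = InBox-cell⁺ as≤vs vs≤bs l

InBox-cell⁻ : ∀ {n} (a b : Vec ℕ n) {c} → InBox (cell a) (cell b) c → ∃[ v ] (c ≡ cell v × a ≤ᵛ v × v ≤ᵛ b)
InBox-cell⁻ [] [] {[]} _ = [] , refl , [] , []
InBox-cell⁻ (a ∷ as) (b ∷ bs) {x ∷ cs} in-box with in-box zero | InBox-cell⁻ as bs {cs} (in-box ∘ suc)
... | +≤+ a≤v , +≤+ v≤b | vs , refl , as≤vs , vs≤bs = _ ∷ vs , refl , a≤v ∷ as≤vs , v≤b ∷ vs≤bs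

range : ℕ → ℕ → List ℕ
range a b = applyUpTo (a +_) (suc b ∸ a)

∈-range⁻ : ∀ {a b y} → y ∈ range a b → a ≤ y × y ≤ b
∈-range⁻ {a} {b} y∈ with t , t<len , refl ← ∈-applyUpTo⁻ (a +_) y∈ =
  m≤m+n a t , ≤-pred (≤-trans (+-monoʳ-< a t<len) (≤-reflexive (m+[n∸m]≡n a≤1+b)))
  where
  a≤1+b : a ≤ suc b
  a≤1+b = <⇒≤ (m∸n≢0⇒n<m (λ len≡0 → n≮0 (subst (t <_) len≡0 t<len)))

∈-range⁺ : ∀ {a b y} → a ≤ y → y ≤ b → y ∈ range a b
∈-range⁺ {a} {b} a≤y y≤b =
  subst (_∈ range a b) (m+[n∸m]≡n a≤y) (∈-applyUpTo⁺ (a +_) (∸-monoˡ-< (s≤s y≤b) a≤y))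

range-unique : ∀ a b → Unique (range a b)
range-unique a b = Unique.applyUpTo⁺₁ (a +_) _ (λ i<j _ eq → <-irrefl (+-cancelˡ-≡ a _ _ eq) i<j)

box : ∀ {n} → Vec ℕ n → Vec ℕ n → List (Vec ℕ n)
box [] [] = [] ∷ []
box (a ∷ as) (b ∷ bs) = concatMap (λ y → map (y ∷_) (box as bs)) (range a b)

∈-box⁻ : ∀ {n} (a b : Vec ℕ n) {v} → v ∈ box a b → a ≤ᵛ v × v ≤ᵛ b
∈-box⁻ [] [] (here refl) = [] , []
∈-box⁻ (a ∷ as) (b ∷ bs) v∈ with ∈-concatMap⁻-∃ (λ y → map (y ∷_) (box as bs)) (range a b) v∈
... | y , y∈ , p with ∈-map⁻ (y ∷_) p
... | vs , vs∈ , refl =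
  let a≤y , y≤b = ∈-range⁻ y∈ ; as≤vs , vs≤bs = ∈-box⁻ as bs vs∈ in (a≤y ∷ as≤vs) , (y≤b ∷ vs≤bs)

∈-box⁺ : ∀ {n} {a b v : Vec ℕ n} → a ≤ᵛ v → v ≤ᵛ b → v ∈ box a b
∈-box⁺ [] [] = here refl
∈-box⁺ {a = a ∷ as} {b ∷ bs} {y ∷ vs} (a≤y ∷ as≤vs) (y≤b ∷ vs≤bs) =
  ∈-concatMap⁺-∈ (λ y → map (y ∷_) (box as bs)) (∈-range⁺ a≤y y≤b) (∈-map⁺ (y ∷_) (∈-box⁺ as≤vs vs≤bs))

-- The polyhypercube of a tuple of words

segment : List ℕ → ℕ → List (ℤ × ℤ)
segment w i = map (λ y → ℤ.+ i , ℤ.+ y) (range (lower w i) (upper w i))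

-- The projection onto the plane (i₁, i_l) of a polycube whose l-th word is w.
shadow : ℕ → List ℕ → List (ℤ × ℤ)
shadow k w = concatMap (segment w) (upTo k)

shadow-unique : ∀ k w → Unique (shadow k w)
shadow-unique k w = concatMap-unique (segment w) (∣_∣ ∘ proj₁) (Unique.upTo⁺ k)
  (λ i → Unique.map⁺ (λ { refl → refl }) (range-unique (lower w i) (upper w i)))
  (λ i p → case ∈-map⁻ _ p of λ { (_ , _ , refl) → refl })

length-shadow : ∀ {k w} → IsWord k w → length (shadow k w) ≡ sum w + k
length-shadow {k} {w} w-word = begin
  length (shadow k w)                     ≡⟨ length-concatMap (segment w) (upTo k) ⟩
  sum (map (length ∘ segment w) (upTo k)) ≡⟨ cong sum (map-upTo _ k) ⟩
  sum (applyUpTo (length ∘ segment w) k)  ≡⟨ cong sum (applyUpTo-cong length-segment k) ⟩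
  sum (applyUpTo (intervalSize w) k)      ≡⟨ sum-intervalSize w-word ⟩
  sum w + k                               ∎
  where
  open ≡-Reasoning
  length-segment : ∀ i → length (segment w i) ≡ intervalSize w i
  length-segment i = trans (length-map _ (range (lower w i) (upper w i))) (length-applyUpTo _ _)

lowers : ∀ {e} → Vec (List ℕ) e → ℕ → Vec ℕ e
lowers ws i = Vec.map (λ w → lower w i) ws

uppers : ∀ {e} → Vec (List ℕ) e → ℕ → Vec ℕ e
uppers ws i = Vec.map (λ w → upper w i) ws

module _ {e} (k : ℕ) (ws : Vec (List ℕ) e) where

  polycube : Poly (suc e)
  polycube = concatMap (λ i → map (λ y → cell (i ∷ y)) (box (lowers ws i) (uppers ws i))) (upTo k)

  InPolycube : Cell (suc e) → Set
  InPolycube c = ∃[ i ] ∃[ y ] (i < k × lowers ws i ≤ᵛ y × y ≤ᵛ uppers ws i × c ≡ cell (i ∷ y))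

  ∈-polycube⁻ : ∀ {c} → c ∈ polycube → InPolycube c
  ∈-polycube⁻ c∈ with ∈-concatMap⁻-∃ (λ i → map (λ y → cell (i ∷ y)) (box (lowers ws i) (uppers ws i))) (upTo k) c∈
  ... | i , i∈ , p with ∈-map⁻ (λ y → cell (i ∷ y)) p
  ... | y , y∈ , refl =
    let lo≤y , y≤hi = ∈-box⁻ (lowers ws i) (uppers ws i) y∈ in i , y , ∈-upTo⁻ i∈ , lo≤y , y≤hi , refl

  ∈-polycube⁺ : ∀ {i y} → i < k → lowers ws i ≤ᵛ y → y ≤ᵛ uppers ws i → cell (i ∷ y) ∈ polycube
  ∈-polycube⁺ {i} i<k lo≤y y≤hi =
    ∈-concatMap⁺-∈ (λ i → map (λ y → cell (i ∷ y)) (box (lowers ws i) (uppers ws i))) (∈-upTo⁺ i<k)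
      (∈-map⁺ (λ y → cell (i ∷ y)) (∈-box⁺ lo≤y y≤hi))

pointwise-map : ∀ {e} {P : List ℕ → Set} {R : ℕ → ℕ → Set} {f g : List ℕ → ℕ} {ws : Vec (List ℕ) e} →
  (∀ {w} → P w → R (f w) (g w)) → VecAll.All P ws → Pointwise R (Vec.map f ws) (Vec.map g ws)
pointwise-map r [] = []
pointwise-map r (pw ∷ pws) = r pw ∷ pointwise-map r pws

module _ {e k} {ws : Vec (List ℕ) e} (ws-words : VecAll.All (IsWord k) ws) where

  private
    P = polycube k ws

  lowers≤uppers : ∀ {i} → i < k → lowers ws i ≤ᵛ uppers ws i
  lowers≤uppers i<k = pointwise-map (λ w → lower≤upper w i<k) ws-words

  corner∈polycube : ∀ {i} → i < k → cell (i ∷ lowers ws i) ∈ P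
  corner∈polycube i<k = ∈-polycube⁺ k ws i<k ≤ᵛ-refl (lowers≤uppers i<k)

  stratum⊆polycube : ∀ {i a b} → i < k → lowers ws i ≤ᵛ a → b ≤ᵛ uppers ws i → BoxIn P (i ∷ a) (i ∷ b)
  stratum⊆polycube i<k lo≤a b≤hi (_ ∷ v) (i≤j ∷ a≤v) (j≤i ∷ v≤b) with refl ← ≤-antisym j≤i i≤j =
    ∈-polycube⁺ k ws i<k (≤ᵛ-trans lo≤a a≤v) (≤ᵛ-trans v≤b b≤hi)

  -- The lowest corner of stratum i + 1 is one step above a cell of stratum i, because the words are staircases.
  Reach-corner : ∀ {i} → i < k → Reach P (cell (0 ∷ lowers ws 0)) (cell (i ∷ lowers ws i))
  Reach-corner {zero} 0<k = start (corner∈polycube 0<k)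
  Reach-corner {suc i} 1+i<k =
    subst (Reach P _) (stepUp-cell zero (i ∷ lowers ws (suc i)))
      (next (Reach-trans (Reach-corner i<k)
                         (Reach-box P (≤-refl ∷ lowers-mono) (stratum⊆polycube i<k ≤ᵛ-refl lowers≤uppers′)))
            zero (subst (_∈ P) (sym (stepUp-cell zero (i ∷ lowers ws (suc i)))) (corner∈polycube 1+i<k)))
    where
    i<k = <-trans (n<1+n i) 1+i<k
    lowers-mono = pointwise-map (λ w → lower≤lower-suc w 1+i<k) ws-words
    lowers≤uppers′ = pointwise-map (λ w → lower-suc≤upper w 1+i<k) ws-words

  polycube-directed : 1 ≤ k → Directed P
  polycube-directed 1≤k = cell (0 ∷ lowers ws 0) , corner∈polycube 1≤k , reach
    where
    reach : ∀ c → c ∈ P → Reach P (cell (0 ∷ lowers ws 0)) c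
    reach c c∈ with i , y , i<k , lo≤y , y≤hi , refl ← ∈-polycube⁻ k ws c∈ =
      Reach-trans (Reach-corner i<k) (Reach-box P (≤-refl ∷ lo≤y) (stratum⊆polycube i<k ≤ᵛ-refl y≤hi))

  polycube-plateau : Plateau P
  polycube-plateau c c∈ with i , y , i<k , _ , _ , refl ← ∈-polycube⁻ k ws c∈ =
    cell (i ∷ lowers ws i) , cell (i ∷ uppers ws i) , λ c′ → mk⇔ to from
    where
    to : ∀ {c′} → c′ ∈ P × x₁ c′ ≡ ℤ.+ i → InBox (cell (i ∷ lowers ws i)) (cell (i ∷ uppers ws i)) c′
    to (c′∈ , x₁≡i) with i′ , y′ , _ , lo≤y′ , y′≤hi , refl ← ∈-polycube⁻ k ws c′∈
                    with refl ← ℤₚ.+-injective x₁≡i =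
      InBox-cell⁺ (≤-refl ∷ lo≤y′) (≤-refl ∷ y′≤hi)
    from : ∀ {c′} → InBox (cell (i ∷ lowers ws i)) (cell (i ∷ uppers ws i)) c′ → c′ ∈ P × x₁ c′ ≡ ℤ.+ i
    from {c′} in-box
                with j ∷ v , refl , i≤j ∷ lo≤v , j≤i ∷ v≤hi ← InBox-cell⁻ (i ∷ lowers ws i) (i ∷ uppers ws i) {c′} in-box
                with refl ← ≤-antisym j≤i i≤j = ∈-polycube⁺ k ws i<k lo≤v v≤hi , refl

  width-polycube : width P ≡ k
  width-polycube =
    trans (length-deduplicate-≡ ℤ._≟_ (map x₁ P) strata-unique ⊆strata strata⊆) (length-applyUpTo _ k)
    where
    strata = applyUpTo (λ i → ℤ.+ i) k
    strata-unique : Unique strata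
    strata-unique = Unique.applyUpTo⁺₁ _ k (λ i<j _ eq → <-irrefl (ℤₚ.+-injective eq) i<j)
    ⊆strata : map x₁ P ⊆ strata
    ⊆strata x∈ with c , c∈ , refl ← ∈-map⁻ x₁ x∈ with _ , _ , i<k , _ , _ , refl ← ∈-polycube⁻ k ws c∈ =
      ∈-applyUpTo⁺ _ i<k
    strata⊆ : strata ⊆ map x₁ P
    strata⊆ x∈ with i , i<k , refl ← ∈-applyUpTo⁻ _ x∈ = ∈-map⁺ x₁ (corner∈polycube i<k)

  projArea-polycube : ∀ l → projArea P (suc l) ≡ sum (Vec.lookup ws l) + k
  projArea-polycube l =
    trans (length-deduplicate-≡ (≡-dec ℤ._≟_ ℤ._≟_) (map project P) (shadow-unique k w) ⊆shadow shadow⊆)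
          (length-shadow (VecAll.lookup⁺ ws-words l))
    where
    w = Vec.lookup ws l
    project : Cell (suc e) → ℤ × ℤ
    project c = x₁ c , Vec.lookup c (suc l)
    lookup-lowers : ∀ i → Vec.lookup (lowers ws i) l ≡ lower w i
    lookup-lowers i = Vec.lookup-map l _ ws
    lookup-uppers : ∀ i → Vec.lookup (uppers ws i) l ≡ upper w i
    lookup-uppers i = Vec.lookup-map l _ ws
    ⊆shadow : map project P ⊆ shadow k w
    ⊆shadow p∈ with c , c∈ , refl ← ∈-map⁻ project p∈
               with i , y , i<k , lo≤y , y≤hi , refl ← ∈-polycube⁻ k ws c∈ =
      subst (_∈ shadow k w) (cong (ℤ.+ i ,_) (sym (lookup-cell y l)))
        (∈-concatMap⁺-∈ (segment w) (∈-upTo⁺ i<k)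
          (∈-map⁺ _ (∈-range⁺ (subst (_≤ Vec.lookup y l) (lookup-lowers i) (Pointwise.lookup lo≤y l))
                              (subst (Vec.lookup y l ≤_) (lookup-uppers i) (Pointwise.lookup y≤hi l)))))
    shadow⊆ : shadow k w ⊆ map project P
    shadow⊆ p∈ with i , i∈ , q ← ∈-concatMap⁻-∃ (segment w) (upTo k) p∈ with y , y∈ , refl ← ∈-map⁻ _ q =
      subst (_∈ map project P)
        (cong (ℤ.+ i ,_) (trans (lookup-cell v l) (cong (λ x → ℤ.+ x) (Vec.lookup∘update l (lowers ws i) y))))
        (∈-map⁺ project (∈-polycube⁺ k ws i<k (proj₁ v-bounds) (proj₂ v-bounds)))
      where
      i<k = ∈-upTo⁻ i∈
      v = lowers ws i Vec.[ l ]≔ y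
      y-bounds = ∈-range⁻ y∈
      v-bounds = ≤ᵛ-update (lowers≤uppers i<k) l (subst (_≤ y) (sym (lookup-lowers i)) (proj₁ y-bounds))
                                                 (subst (y ≤_) (sym (lookup-uppers i)) (proj₂ y-bounds))

lateralArea-projArea : ∀ {e} (P : Poly (suc e)) → lateralArea P ≡ sum (List.tabulate (λ l → projArea P (suc l)))
lateralArea-projArea P = cong sum (trans (cong (map (projArea P)) (filter-lateral id)) (map-tabulate Fin.suc (projArea P)))
  where
  filter-lateral : ∀ {e m} (g : Fin m → Fin e) →
    List.filter (λ l → 1 ≤? toℕ l) (List.tabulate (Fin.suc ∘ g)) ≡ List.tabulate (Fin.suc ∘ g)
  filter-lateral {m = zero} g = refl
  filter-lateral {m = suc m} g = cong (suc (g zero) ∷_) (filter-lateral (g ∘ suc))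

areas : ∀ {e} → ℕ → Vec (List ℕ) e → List ℕ
areas k ws = List.tabulate (λ l → sum (Vec.lookup ws l) + k)

module _ {e k} {ws : Vec (List ℕ) e} (ws-words : VecAll.All (IsWord k) ws) where

  lateralArea-polycube : lateralArea (polycube k ws) ≡ sum (areas k ws)
  lateralArea-polycube = trans (lateralArea-projArea (polycube k ws)) (cong sum (tabulate-cong (projArea-polycube ws-words)))

  polycube-DPP : 1 ≤ k → DPP (suc e) k (sum (areas k ws)) (polycube k ws)
  polycube-DPP 1≤k = Directed⇒Connected (polycube-directed ws-words 1≤k) , polycube-directed ws-words 1≤k ,
                     polycube-plateau ws-words , width-polycube ws-words , lateralArea-polycube

origin : ∀ {n} → Cell n
origin = Vec.replicate _ 0ℤ

NonNegative : ∀ {n} → Poly n → Set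
NonNegative P = ∀ {c} → c ∈ P → ∃[ v ] (c ≡ cell v)

opposite-cells⇒origin : ∀ {n} {t : Cell n} {u v : Vec ℕ n} → t ≡ cell u → Vec.map ℤ.-_ t ≡ cell v → t ≡ origin
opposite-cells⇒origin {t = []} {[]} {[]} _ _ = refl
opposite-cells⇒origin {t = _ ∷ _} {zero ∷ _} {_ ∷ _} t≡u -t≡v
  with refl , eqᵗ ← Vec.∷-injective t≡u | _ , eqᵗ′ ← Vec.∷-injective -t≡v =
  cong (0ℤ ∷_) (opposite-cells⇒origin eqᵗ eqᵗ′)
opposite-cells⇒origin {t = _ ∷ _} {suc _ ∷ _} {_ ∷ _} t≡u -t≡v
  with refl , _ ← Vec.∷-injective t≡u | () , _ ← Vec.∷-injective -t≡v

-- The translation t and its opposite are images of the origin, hence nonnegative cells, so t is the origin.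
≈ₜ-origin⇒same-cells : ∀ {n} {P Q : Poly n} → NonNegative P → NonNegative Q → origin ∈ P → origin ∈ Q →
  P ≈ₜ Q → P ⊆ Q × Q ⊆ P
≈ₜ-origin⇒same-cells {P = P} {Q} P≥0 Q≥0 o∈P o∈Q (t , translate) =
  (λ {c} c∈P → subst (_∈ Q) (+t≡id c) (Equivalence.to (translate c) c∈P)) ,
  (λ {c} c∈Q → Equivalence.from (translate c) (subst (_∈ Q) (sym (+t≡id c)) c∈Q))
  where
  t∈Q : t ∈ Q
  t∈Q = subst (_∈ Q) (Vec.zipWith-identityˡ ℤₚ.+-identityˡ t) (Equivalence.to (translate origin) o∈P)
  -t∈P : Vec.map ℤ.-_ t ∈ P
  -t∈P = Equivalence.from (translate _) (subst (_∈ Q) (sym (Vec.zipWith-inverseˡ ℤₚ.+-inverseˡ t)) o∈Q)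
  t≡origin : t ≡ origin
  t≡origin = opposite-cells⇒origin (proj₂ (Q≥0 t∈Q)) (proj₂ (P≥0 -t∈P))
  +t≡id : ∀ c → Vec.zipWith ℤ._+_ c t ≡ c
  +t≡id c = trans (cong (Vec.zipWith ℤ._+_ c) t≡origin) (Vec.zipWith-identityʳ ℤₚ.+-identityʳ c)

polycube-nonNegative : ∀ {e} k (ws : Vec (List ℕ) e) → NonNegative (polycube k ws)
polycube-nonNegative k ws c∈ with i , y , _ , _ , _ , refl ← ∈-polycube⁻ k ws c∈ = i ∷ y , refl

module _ {e k} {ws ws′ : Vec (List ℕ) e} (ws-words : VecAll.All (IsWord k) ws) where

  polycube-⊆⇒bounds : polycube k ws ⊆ polycube k ws′ → ∀ {i} → i < k →
    lowers ws′ i ≤ᵛ lowers ws i × uppers ws i ≤ᵛ uppers ws′ i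
  polycube-⊆⇒bounds ⊆ {i} i<k = lowers-bound , uppers-bound
    where
    lowers-bound : lowers ws′ i ≤ᵛ lowers ws i
    lowers-bound with _ , _ , _ , lo≤ , _ , eq ← ∈-polycube⁻ k ws′ (⊆ (corner∈polycube ws-words i<k))
                 with refl ← cell-injective eq = lo≤
    uppers-bound : uppers ws i ≤ᵛ uppers ws′ i
    uppers-bound
      with _ , _ , _ , _ , ≤hi , eq ← ∈-polycube⁻ k ws′ (⊆ (∈-polycube⁺ k ws i<k (lowers≤uppers ws-words i<k) ≤ᵛ-refl))
                 with refl ← cell-injective eq = ≤hi

words-ext : ∀ {e k} {ws ws′ : Vec (List ℕ) e} → VecAll.All (IsWord k) ws → VecAll.All (IsWord k) ws′ →
  (∀ i → i < k → lowers ws i ≡ lowers ws′ i × uppers ws i ≡ uppers ws′ i) → ws ≡ ws′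
words-ext [] [] _ = refl
words-ext (w-word ∷ ws-words) (w′-word ∷ ws′-words) same = cong₂ _∷_
  (IsWord-ext w-word w′-word (λ i i<k → let lo , up = same i i<k in proj₁ (Vec.∷-injective lo) , proj₁ (Vec.∷-injective up)))
  (words-ext ws-words ws′-words (λ i i<k → let lo , up = same i i<k in proj₂ (Vec.∷-injective lo) , proj₂ (Vec.∷-injective up)))

origin∈polycube : ∀ {e k} {ws : Vec (List ℕ) e} → VecAll.All (IsWord k) ws → 1 ≤ k → origin ∈ polycube k ws
origin∈polycube {e} {k} {ws} ws-words 1≤k =
  subst (_∈ polycube k ws) (cong (0ℤ ∷_) (trans (cong cell (Vec.map-const ws 0)) (Vec.map-replicate _ 0 e)))
    (corner∈polycube ws-words 1≤k)

polycube-injective : ∀ {e k} {ws ws′ : Vec (List ℕ) e} → 1 ≤ k →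
  VecAll.All (IsWord k) ws → VecAll.All (IsWord k) ws′ → polycube k ws ≈ₜ polycube k ws′ → ws ≡ ws′
polycube-injective {k = k} {ws} {ws′} 1≤k ws-words ws′-words P≈P′ = words-ext ws-words ws′-words same-bounds
  where
  same-cells = ≈ₜ-origin⇒same-cells (polycube-nonNegative k ws) (polycube-nonNegative k ws′)
                 (origin∈polycube ws-words 1≤k) (origin∈polycube ws′-words 1≤k) P≈P′
  same-bounds : ∀ i → i < k → lowers ws i ≡ lowers ws′ i × uppers ws i ≡ uppers ws′ i
  same-bounds i i<k =
    let lo′≤lo , hi≤hi′ = polycube-⊆⇒bounds ws-words (proj₁ same-cells) i<k
        lo≤lo′ , hi′≤hi = polycube-⊆⇒bounds ws′-words (proj₂ same-cells) i<k
    in ≤ᵛ-antisym lo≤lo′ lo′≤lo , ≤ᵛ-antisym hi≤hi′ hi′≤hi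

-- Translation invariance

module _ {n} {B : Set} (_≟_ : DecidableEquality B) {P Q : Poly n} where

  length-deduplicate-≈ₜ : (π : Cell n → B) (τ : Cell n → B → B) → (∀ t {x y} → τ t x ≡ τ t y → x ≡ y) →
    (∀ c t → π (Vec.zipWith ℤ._+_ c t) ≡ τ t (π c)) → P ≈ₜ Q →
    length (deduplicate _≟_ (map π P)) ≡ length (deduplicate _≟_ (map π Q))
  length-deduplicate-≈ₜ π τ τ-injective π-translate (t , translate) =
    length-deduplicate-image _≟_ _≟_ (τ t) (τ-injective t) (map π P) (map π Q) image⊆ ⊆image
    where
    -t+t≡id : ∀ c → Vec.zipWith ℤ._+_ (Vec.zipWith ℤ._+_ c (Vec.map ℤ.-_ t)) t ≡ c
    -t+t≡id c = trans (Vec.zipWith-assoc ℤₚ.+-assoc c _ t)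
                      (trans (cong (Vec.zipWith ℤ._+_ c) (Vec.zipWith-inverseˡ ℤₚ.+-inverseˡ t))
                             (Vec.zipWith-identityʳ ℤₚ.+-identityʳ c))
    image⊆ : map (τ t) (map π P) ⊆ map π Q
    image⊆ y∈ with x , x∈ , refl ← ∈-map⁻ (τ t) y∈ with c , c∈ , refl ← ∈-map⁻ π x∈ =
      subst (_∈ map π Q) (π-translate c t) (∈-map⁺ π (Equivalence.to (translate c) c∈))
    ⊆image : ∀ {y} → y ∈ map π Q → ∃[ x ] (x ∈ map π P × y ≡ τ t x)
    ⊆image y∈ with c , c∈ , refl ← ∈-map⁻ π y∈ =
      π c-t , ∈-map⁺ π (Equivalence.from (translate c-t) (subst (_∈ Q) (sym (-t+t≡id c)) c∈)) ,
      trans (cong π (sym (-t+t≡id c))) (π-translate c-t t)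
      where c-t = Vec.zipWith ℤ._+_ c (Vec.map ℤ.-_ t)

module _ {e} {P Q : Poly (suc e)} (P≈Q : P ≈ₜ Q) where

  private
    x₁-translate : ∀ (c t : Cell (suc e)) → x₁ (Vec.zipWith ℤ._+_ c t) ≡ x₁ c ℤ.+ Vec.head t
    x₁-translate (_ ∷ _) (_ ∷ _) = refl

  width-≈ₜ : width P ≡ width Q
  width-≈ₜ = length-deduplicate-≈ₜ ℤ._≟_ x₁ (λ t x → x ℤ.+ Vec.head t) (λ t → +-cancelʳ-ℤ _ _ _) x₁-translate P≈Q

  projArea-≈ₜ : ∀ l → projArea P l ≡ projArea Q l
  projArea-≈ₜ l = length-deduplicate-≈ₜ (≡-dec ℤ._≟_ ℤ._≟_) (λ c → x₁ c , Vec.lookup c l)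
    (λ t (x , y) → x ℤ.+ Vec.head t , y ℤ.+ Vec.lookup t l)
    (λ t eq → cong₂ _,_ (+-cancelʳ-ℤ _ _ _ (cong proj₁ eq)) (+-cancelʳ-ℤ _ _ _ (cong proj₂ eq)))
    (λ c t → cong₂ _,_ (x₁-translate c t) (Vec.lookup-zipWith ℤ._+_ l c t))
    P≈Q

  lateralArea-≈ₜ : lateralArea P ≡ lateralArea Q
  lateralArea-≈ₜ = trans (lateralArea-projArea P)
    (trans (cong sum (tabulate-cong (projArea-≈ₜ ∘ Fin.suc))) (sym (lateralArea-projArea Q)))

-- Directed plateau polyhypercubes are translates of polycubes

module _ {e} {P : Poly (suc e)} where

  -- Along a path of elementary steps, the first coordinate increases by at most one at a time.
  Reach-strata : ∀ {a b} → Reach P a b → ∀ i → x₁ a ℤ.+ ℤ.+ i ℤ.≤ x₁ b →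
    Any (λ c → x₁ c ≡ x₁ a ℤ.+ ℤ.+ i) P
  Reach-strata {a} (start a∈) i a+i≤a with refl ← x+n≤x⇒n≡0 a+i≤a =
    Any.map (λ { refl → sym (ℤₚ.+-identityʳ (x₁ a)) }) a∈
  Reach-strata (next {b = _ ∷ _} p (suc _) _) i a+i≤b = Reach-strata p i a+i≤b
  Reach-strata (next {b = x ∷ _} p zero c∈) i a+i≤x+1 with ≤+1⇒≤∨≡+1 {x} a+i≤x+1
  ... | inj₁ a+i≤x = Reach-strata p i a+i≤x
  ... | inj₂ a+i≡x+1 = Any.map (λ { refl → sym a+i≡x+1 }) c∈

module _ {d} {P : Poly d} (P-plateau : Plateau P) where

  StratumBox : ℤ → Set
  StratumBox x = Σ (Cell d × Cell d) λ (lo , hi) →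
    Any (λ c → x₁ c ≡ x) P → ∀ c → (c ∈ P × x₁ c ≡ x) ⇔ InBox lo hi c

  stratumBox : ∀ x → StratumBox x
  stratumBox x with Any.any? (λ c → x₁ c ℤ.≟ x) P
  ... | no empty = (origin , origin) , λ occupied → ⊥-elim (empty occupied)
  ... | yes occupied with c , c∈ , refl ← find occupied with lo , hi , box ← P-plateau c c∈ = (lo , hi) , λ _ → box

module Completeness {e} (P : Poly (suc e)) (P-directed : Directed P) (P-plateau : Plateau P) where

  r : Cell (suc e)
  r = proj₁ P-directed

  r∈P : r ∈ P
  r∈P = proj₁ (proj₂ P-directed)

  r≤ᶜ : ∀ {c} → c ∈ P → r ≤ᶜ c
  r≤ᶜ {c} c∈ = Reach-≤ᶜ (proj₂ (proj₂ P-directed) c c∈)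

  height : Cell (suc e) → ℕ
  height c = Vec.head (displacement r c)

  top : Cell (suc e)
  top = argmax height r P

  K : ℕ
  K = suc (height top)

  height<K : ∀ {c} → c ∈ P → height c < K
  height<K c∈ = s≤s (All.lookup (f[xs]≤f[argmax] {f = height} r P) c∈)

  InStratum : ℕ → Cell (suc e) → Set
  InStratum i c = c ∈ P × x₁ c ≡ x₁ r ℤ.+ ℤ.+ i

  InStratum⇒height : ∀ {i c} → InStratum i c → height c ≡ i
  InStratum⇒height {i} {c} (c∈ , x₁≡) =
    ℤₚ.+-injective (+-cancelˡ-ℤ (x₁ r) _ _ (trans (sym (x₁-displacement (r≤ᶜ c∈))) x₁≡))

  stratum-nonempty : ∀ {i} → i < K → Any (λ c → x₁ c ≡ x₁ r ℤ.+ ℤ.+ i) P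
  stratum-nonempty {i} (s≤s i≤top) = Reach-strata (proj₂ (proj₂ P-directed) top top∈P) i
    (subst (x₁ r ℤ.+ ℤ.+ i ℤ.≤_) (sym (x₁-displacement (r≤ᶜ top∈P))) (ℤₚ.+-monoʳ-≤ (x₁ r) (+≤+ i≤top)))
    where
    top∈P : top ∈ P
    top∈P = argmax-all height r∈P (All.tabulate id)

  lo hi : ℕ → Cell (suc e)
  lo i = proj₁ (proj₁ (stratumBox P-plateau (x₁ r ℤ.+ ℤ.+ i)))
  hi i = proj₂ (proj₁ (stratumBox P-plateau (x₁ r ℤ.+ ℤ.+ i)))

  InStratum⇔InBox : ∀ {i} → i < K → ∀ c → InStratum i c ⇔ InBox (lo i) (hi i) c
  InStratum⇔InBox {i} i<K = proj₂ (stratumBox P-plateau (x₁ r ℤ.+ ℤ.+ i)) (stratum-nonempty i<K)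

  lo≤ᶜhi : ∀ {i} → i < K → lo i ≤ᶜ hi i
  lo≤ᶜhi i<K with c , c∈ , x₁≡ ← find (stratum-nonempty i<K) =
    let lo≤c , c≤hi = InBox⇒≤ᶜ {c = c} (Equivalence.to (InStratum⇔InBox i<K c) (c∈ , x₁≡))
    in Pointwise.trans ℤₚ.≤-trans lo≤c c≤hi

  lo-InStratum : ∀ {i} → i < K → InStratum i (lo i)
  lo-InStratum i<K = Equivalence.from (InStratum⇔InBox i<K _) (≤ᶜ⇒InBox (Pointwise.refl ℤₚ.≤-refl) (lo≤ᶜhi i<K))

  hi-InStratum : ∀ {i} → i < K → InStratum i (hi i)
  hi-InStratum i<K = Equivalence.from (InStratum⇔InBox i<K _) (≤ᶜ⇒InBox (lo≤ᶜhi i<K) (Pointwise.refl ℤₚ.≤-refl))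

  lo0≡r : lo 0 ≡ r
  lo0≡r = Pointwise-antisym ℤₚ.≤-antisym
    (proj₁ (InBox⇒≤ᶜ {hi = hi 0} (Equivalence.to (InStratum⇔InBox (s≤s z≤n) r) (r∈P , sym (ℤₚ.+-identityʳ (x₁ r))))))
    (r≤ᶜ (proj₁ (lo-InStratum (s≤s z≤n))))

  -- The lowest corner of stratum i + 1 is reached by a step from a cell below it: a step along
  -- a lateral axis would leave the box of stratum i + 1, so it is a step along the first axis
  -- from a cell of stratum i.
  lo-suc-nested : ∀ {i} → suc i < K → ∀ l →
    Vec.lookup (lo i) (suc l) ℤ.≤ Vec.lookup (lo (suc i)) (suc l) × Vec.lookup (lo (suc i)) (suc l) ℤ.≤ Vec.lookup (hi i) (suc l)
  lo-suc-nested {i} 1+i<K l with lo-InStratum 1+i<K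
  ... | lo∈ , x₁≡ with Reach-last-step (proj₂ (proj₂ P-directed) _ lo∈)
  ... | inj₁ lo≡r with () ← x+n≤x⇒n≡0 (ℤₚ.≤-reflexive (trans (sym x₁≡) (cong x₁ lo≡r)))
  ... | inj₂ (x ∷ bs , zero , b∈ , lo≡b+1) =
    subst₂ ℤ._≤_ refl (sym lateral≡) lo≤b , subst₂ ℤ._≤_ (sym lateral≡) refl b≤hi
    where
    x≡ : x ≡ x₁ r ℤ.+ ℤ.+ i
    x≡ = +-cancelʳ-ℤ 1ℤ x _ (trans (trans (cong x₁ (sym lo≡b+1)) x₁≡) (x+[1+n]≡x+n+1 (x₁ r) i))
    in-box = Equivalence.to (InStratum⇔InBox (<-trans (n<1+n i) 1+i<K) (x ∷ bs)) (b∈ , x≡)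
    lo≤b = proj₁ (in-box (suc l))
    b≤hi = proj₂ (in-box (suc l))
    lateral≡ : Vec.lookup (lo (suc i)) (suc l) ≡ Vec.lookup bs l
    lateral≡ = cong (λ c → Vec.lookup c (suc l)) lo≡b+1
  ... | inj₂ (x ∷ bs , suc j , b∈ , lo≡b+1) =
    ⊥-elim (x+1≰x (Vec.lookup bs j) (subst (ℤ._≤ Vec.lookup bs j) lateral≡ lo≤b))
    where
    in-box = Equivalence.to (InStratum⇔InBox 1+i<K (x ∷ bs)) (b∈ , trans (cong x₁ (sym lo≡b+1)) x₁≡)
    lo≤b = proj₁ (in-box (suc j))
    lateral≡ : Vec.lookup (lo (suc i)) (suc j) ≡ Vec.lookup bs j ℤ.+ 1ℤ
    lateral≡ = trans (cong (λ c → Vec.lookup c (suc j)) lo≡b+1) (Vec.lookup∘updateAt j bs)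

  offsetLo offsetHi : Fin e → ℕ → ℕ
  offsetLo l i = Vec.lookup (displacement r (lo i)) (suc l)
  offsetHi l i = Vec.lookup (displacement r (hi i)) (suc l)

  offsets-staircase : ∀ l → IsStaircase K (offsetLo l) (offsetHi l)
  offsets-staircase l =
    (λ i i<K → mono (lo-InStratum i<K) (hi-InStratum i<K) (Pointwise.lookup (lo≤ᶜhi i<K) (suc l))) ,
    (λ i 1+i<K → let i<K = <-trans (n<1+n i) 1+i<K ; lo≤lo′ , lo′≤hi = lo-suc-nested 1+i<K l
                 in mono (lo-InStratum i<K) (lo-InStratum 1+i<K) lo≤lo′ , mono (lo-InStratum 1+i<K) (hi-InStratum i<K) lo′≤hi)
    where
    mono : ∀ {i j a b} → InStratum i a → InStratum j b → Vec.lookup a (suc l) ℤ.≤ Vec.lookup b (suc l) →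
      Vec.lookup (displacement r a) (suc l) ≤ Vec.lookup (displacement r b) (suc l)
    mono (a∈ , _) (b∈ , _) = displacement-lookup-mono (r≤ᶜ a∈) (r≤ᶜ b∈) (suc l)

  word : Fin e → List ℕ
  word l = wordOfIntervals K (offsetLo l) (offsetHi l)

  ws : Vec (List ℕ) e
  ws = Vec.tabulate word

  ws-words : VecAll.All (IsWord K) ws
  ws-words = VecAll.lookup⁻ (λ l → subst (IsWord K) (sym (Vec.lookup∘tabulate word l)) (IsWord-wordOfIntervals _ _ _))

  offsetLo-0 : ∀ l → offsetLo l 0 ≡ 0
  offsetLo-0 l = trans (cong (λ c → Vec.lookup (displacement r c) (suc l)) lo0≡r)
                       (trans (cong (λ v → Vec.lookup v (suc l)) (displacement-self r)) (Vec.lookup-replicate (suc l) 0))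

  displacement-corners : ∀ {i} → i < K → displacement r (lo i) ≡ i ∷ lowers ws i × displacement r (hi i) ≡ i ∷ uppers ws i
  displacement-corners {i} i<K =
    corner (lo-InStratum i<K) (λ l → trans (cong (_+ lower (word l) i) (sym (offsetLo-0 l))) (proj₁ (bounds l))) ,
    corner (hi-InStratum i<K) (λ l → trans (cong (_+ upper (word l) i) (sym (offsetLo-0 l))) (proj₂ (bounds l)))
    where
    bounds : ∀ l → offsetLo l 0 + lower (word l) i ≡ offsetLo l i × offsetLo l 0 + upper (word l) i ≡ offsetHi l i
    bounds l = lower-upper-wordOfIntervals K (offsetLo l) (offsetHi l) (offsets-staircase l) i i<K
    corner : ∀ {c} {f : List ℕ → ℕ} → InStratum i c → (∀ l → f (word l) ≡ Vec.lookup (displacement r c) (suc l)) →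
      displacement r c ≡ i ∷ Vec.map f ws
    corner {c} {f} c-stratum f≡ = begin
      displacement r c
        ≡⟨ head∷tabulate (displacement r c) ⟩
      height c ∷ Vec.tabulate (λ l → Vec.lookup (displacement r c) (suc l))
        ≡⟨ cong₂ _∷_ (InStratum⇒height c-stratum) (Vec.tabulate-cong (sym ∘ f≡)) ⟩
      i ∷ Vec.tabulate (f ∘ word)
        ≡⟨ cong (i ∷_) (Vec.tabulate-∘ f word) ⟩
      i ∷ Vec.map f ws ∎
      where open ≡-Reasoning

  ≈ₜ-polycube : P ≈ₜ polycube K ws
  ≈ₜ-polycube = Vec.map ℤ.-_ r , λ c → mk⇔ to from
    where
    to : ∀ {c} → c ∈ P → Vec.zipWith ℤ._+_ c (Vec.map ℤ.-_ r) ∈ polycube K ws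
    to {c} c∈ = subst (_∈ polycube K ws) (trans (cong cell (sym disp≡)) (sym (translate-displacement r≤c)))
      (∈-polycube⁺ K ws h<K (Pointwise.tail lo≤disp) (Pointwise.tail disp≤hi))
      where
      r≤c = r≤ᶜ c∈
      h = height c
      h<K = height<K c∈
      y = Vec.tabulate (λ l → Vec.lookup (displacement r c) (suc l))
      disp≡ : displacement r c ≡ h ∷ y
      disp≡ = head∷tabulate (displacement r c)
      lo≤c,c≤hi = InBox⇒≤ᶜ (Equivalence.to (InStratum⇔InBox h<K c) (c∈ , x₁-displacement r≤c))
      lo≤disp : h ∷ lowers ws h ≤ᵛ h ∷ y
      lo≤disp = subst₂ _≤ᵛ_ (proj₁ (displacement-corners h<K)) disp≡
        (Equivalence.to (displacement-mono (r≤ᶜ (proj₁ (lo-InStratum h<K))) r≤c) (proj₁ lo≤c,c≤hi))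
      disp≤hi : h ∷ y ≤ᵛ h ∷ uppers ws h
      disp≤hi = subst₂ _≤ᵛ_ disp≡ (proj₂ (displacement-corners h<K))
        (Equivalence.to (displacement-mono r≤c (r≤ᶜ (proj₁ (hi-InStratum h<K)))) (proj₂ lo≤c,c≤hi))
    from : ∀ {c} → Vec.zipWith ℤ._+_ c (Vec.map ℤ.-_ r) ∈ polycube K ws → c ∈ P
    from {c} c-r∈ with i , y , i<K , lo≤y , y≤hi , eq ← ∈-polycube⁻ K ws c-r∈
                  with r≤c , disp≡ ← translate≡cell⇒displacement eq =
      proj₁ (Equivalence.from (InStratum⇔InBox i<K c) (≤ᶜ⇒InBox lo≤c c≤hi))
      where
      lo≤c : lo i ≤ᶜ c
      lo≤c = Equivalence.from (displacement-mono (r≤ᶜ (proj₁ (lo-InStratum i<K))) r≤c)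
        (subst₂ _≤ᵛ_ (sym (proj₁ (displacement-corners i<K))) (sym disp≡) (≤-refl ∷ lo≤y))
      c≤hi : c ≤ᶜ hi i
      c≤hi = Equivalence.from (displacement-mono r≤c (r≤ᶜ (proj₁ (hi-InStratum i<K))))
        (subst₂ _≤ᵛ_ (sym disp≡) (sym (proj₂ (displacement-corners i<K))) (≤-refl ∷ y≤hi))

-- Counting

module _ {k} (1≤k : 1 ≤ k) where

  ChosenFrom-words⁻ : ∀ {e} {ws : Vec (List ℕ) e} {js} → ChosenFrom ws (map (words k) js) →
    VecAll.All (IsWord k) ws × areas k ws ≡ js
  ChosenFrom-words⁻ {ws = []} {[]} tt = [] , refl
  ChosenFrom-words⁻ {ws = _ ∷ _} {j ∷ _} (w∈ , ws∈) =
    let w-word , area≡j = ∈-words⁻ k j 1≤k w∈ ; ws-words , areas≡js = ChosenFrom-words⁻ ws∈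
    in w-word ∷ ws-words , cong₂ _∷_ area≡j areas≡js

  ChosenFrom-words⁺ : ∀ {e} {ws : Vec (List ℕ) e} → VecAll.All (IsWord k) ws → ChosenFrom ws (map (words k) (areas k ws))
  ChosenFrom-words⁺ [] = tt
  ChosenFrom-words⁺ (w-word ∷ ws-words) = ∈-words⁺ k _ w-word refl , ChosenFrom-words⁺ ws-words

  areas-positive : ∀ {e} (ws : Vec (List ℕ) e) → All (1 ≤_) (areas k ws)
  areas-positive [] = []
  areas-positive (w ∷ ws) = ≤-trans 1≤k (m≤n+m k (sum w)) ∷ areas-positive ws

codes : ℕ → ℕ → (e : ℕ) → List (Vec (List ℕ) e)
codes k n e = concatMap (λ js → choices e (map (words k) js)) (compositions e n)

module _ {k} (1≤k : 1 ≤ k) (n e : ℕ) where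

  length-codes : length (codes k n e) ≡ formula (suc e) k n
  length-codes = trans (length-concatMap _ (compositions e n)) (cong sum (map-cong-local (All.tabulate count)))
    where
    count : ∀ {js} → js ∈ compositions e n → length (choices e (map (words k) js)) ≡ product (map (term k) js)
    count {js} js∈ = begin
      length (choices e (map (words k) js))
        ≡⟨ length-choices e _ (trans (length-map (words k) js) (proj₁ (∈-compositions⁻ e n js∈))) ⟩
      product (map length (map (words k) js))
        ≡⟨ cong product (sym (map-∘ js)) ⟩
      product (map (length ∘ words k) js)
        ≡⟨ cong product (map-cong (λ j → length-words k j 1≤k) js) ⟩
      product (map (term k) js) ∎
      where open ≡-Reasoning

  codes-unique : Unique (codes k n e)
  codes-unique = concatMap-unique (λ js → choices e (map (words k) js)) (areas k) (compositions-unique e n)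
    (λ js → choices-unique e (map (words k) js) (All.map⁺ (All.universal (words-unique k) js)))
    (λ js ws∈ → proj₂ (ChosenFrom-words⁻ 1≤k (∈-choices⁻ e _ ws∈)))

  ∈-codes⁻ : ∀ {ws} → ws ∈ codes k n e → VecAll.All (IsWord k) ws × sum (areas k ws) ≡ n
  ∈-codes⁻ ws∈ with js , js∈ , ws∈′ ← ∈-concatMap⁻-∃ _ (compositions e n) ws∈
               with ws-words , refl ← ChosenFrom-words⁻ 1≤k (∈-choices⁻ e _ ws∈′) =
    ws-words , proj₁ (proj₂ (∈-compositions⁻ e n js∈))

  ∈-codes⁺ : ∀ {ws} → VecAll.All (IsWord k) ws → sum (areas k ws) ≡ n → ws ∈ codes k n e
  ∈-codes⁺ {ws} ws-words sum≡n =
    ∈-concatMap⁺-∈ (λ js → choices e (map (words k) js))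
      (∈-compositions⁺ e n (length-tabulate _) sum≡n (areas-positive 1≤k ws))
      (∈-choices⁺ e _ (ChosenFrom-words⁺ 1≤k ws-words))

theorem2 : (d k n : ℕ) → 3 ≤ d → 1 ≤ k → (d ∸ 1) * k ≤ n →
    IsCountDPP d k n (formula d k n)
theorem2 (suc e) k n _ 1≤k _ =
  map (polycube k) (codes k n e) , trans (length-map (polycube k) (codes k n e)) (length-codes 1≤k n e) , sound , complete ,
  unique-map-≉ (polycube k)
    (λ ws∈ ws′∈ → polycube-injective 1≤k (proj₁ (∈-codes⁻ 1≤k n e ws∈)) (proj₁ (∈-codes⁻ 1≤k n e ws′∈)))
    (codes-unique 1≤k n e)
  where
  sound : ∀ P → P ∈ map (polycube k) (codes k n e) → DPP (suc e) k n P
  sound P P∈ with ws , ws∈ , refl ← ∈-map⁻ _ P∈ with ws-words , refl ← ∈-codes⁻ 1≤k n e ws∈ =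
    polycube-DPP ws-words 1≤k
  complete : ∀ P → DPP (suc e) k n P → Any (P ≈ₜ_) (map (polycube k) (codes k n e))
  complete P (_ , P-directed , P-plateau , width≡k , area≡n) =
    subst (λ k → Any (P ≈ₜ_) (map (polycube k) (codes k n e))) K≡k
      (Any.map (λ { refl → ≈ₜ-polycube }) (∈-map⁺ (polycube K) (∈-codes⁺ (s≤s z≤n) n e ws-words areas≡n)))
    where
    open Completeness P P-directed P-plateau
    K≡k : K ≡ k
    K≡k = trans (sym (width-polycube ws-words)) (trans (sym (width-≈ₜ ≈ₜ-polycube)) width≡k)
    areas≡n : sum (areas K ws) ≡ n
    areas≡n = trans (sym (lateralArea-polycube ws-words)) (trans (sym (lateralArea-≈ₜ ≈ₜ-polycube)) area≡n)
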